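{- Let $f=m_1+\dots+m_t$ be a $0$-intersecting, $k$-homogeneous $n$-variable Boolean function (with $m_1,\dots,m_t$ the distinct monomials of its ANF), and let $G=\prod_{i=0}^{k-1}(2^k-2^i)$. Then \[|N_k(f)|=\frac{2^{kn-1}}{G}\left(1-\left(1-\frac{G}{2^{k^2-1}}\right)^t\right).\]
   Context: A Boolean function in ANF is a sum of distinct monomials $x_I=\prod_{i\in I}x_i$; $\mathrm{Var}(x_I)=I$. $f$ is $k$-homogeneous if all its monomials have degree $k$; $f=m_1+\dots+m_t$ is $0$-intersecting if $\mathrm{Var}(m_i)\cap\mathrm{Var}(m_j)=\emptyset$ for all $i\neq j$. $N_k(f)$ is the set of $k$-dimensional linear subspaces $U$ of $\mathbb{F}_2^n$ with $\sum_{x\in U}f(x)\neq0$. -}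

module Defs where

open import Data.Bool using (Bool; true; false; _∧_; _∨_; not; _xor_; if_then_else_)
open import Data.Nat using (ℕ; zero; suc; _+_; _∸_; _^_; _<_; s≤s; z≤n; NonZero; >-nonZero)
open import Data.Nat.Properties using (^-monoʳ-<; m<n⇒0<n∸m; m*n≢0; m^n≢0)
open import Data.Fin using (Fin)
open import Data.Fin.Subset using (Subset; _∩_; Empty; ∣_∣)
open import Data.Vec using (Vec; []; _∷_; zipWith; replicate)
import Data.Vec as Vec
open import Data.List using (List; []; _∷_; map; foldr; length; filter; _++_)
open import Data.Bool.ListAction using (and; or)
open import Data.List.Relation.Unary.All using (All)
open import Data.List.Relation.Unary.AllPairs using (AllPairs)
open import Data.List.Relation.Unary.Unique.Propositional using (Unique)
open import Data.Vec.Properties using (≡-dec)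
import Data.Bool.Properties as BoolP
open import Relation.Nullary.Decidable using (does)
open import Relation.Binary.PropositionalEquality using (_≡_)
open import Data.Integer using (+_)
open import Data.Rational using (ℚ; _/_; 1ℚ; _-_)
  renaming (_*_ to _*ℚ_)

-- The vector space F₂ⁿ, represented as Vec Bool n (true = 1, xor = +).

F2^ : ℕ → Set
F2^ n = Vec Bool n

_⊕_ : ∀ {n} → F2^ n → F2^ n → F2^ n
_⊕_ = zipWith _xor_

zeroVec : ∀ {n} → F2^ n
zeroVec = replicate _ false

_==_ : ∀ {n} → F2^ n → F2^ n → Bool
u == v = does (≡-dec BoolP._≟_ u v)

allVecs : (n : ℕ) → List (F2^ n)
allVecs zero    = [] ∷ []
allVecs (suc n) = map (false ∷_) (allVecs n) ++ map (true ∷_) (allVecs n)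

-- all sublists (= all subsets, when the input has no repetitions)
sublists : ∀ {a} {A : Set a} → List A → List (List A)
sublists []       = [] ∷ []
sublists (x ∷ xs) = sublists xs ++ map (x ∷_) (sublists xs)

subsetsF2 : (n : ℕ) → List (List (F2^ n))
subsetsF2 n = sublists (allVecs n)

_∈ᵇ_ : ∀ {n} → F2^ n → List (F2^ n) → Bool
v ∈ᵇ U = or (map (v ==_) U)

-- U is a linear subspace of F₂ⁿ: contains 0 and closed under addition
-- (over F₂ this is the same as closure under linear combinations).
isSubspace : ∀ {n} → List (F2^ n) → Bool
isSubspace U = (zeroVec ∈ᵇ U) ∧ and (map (λ u → and (map (λ v → (u ⊕ v) ∈ᵇ U) U)) U)

isSubspaceOfDim : ∀ {n} → ℕ → List (F2^ n) → Bool
isSubspaceOfDim k U = isSubspace U ∧ does (length U Data.Nat.≟ (2 ^ k))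

-- Boolean functions in ANF.
-- A monomial x_I is given by its variable set I = Var(x_I), a Subset n.

Monomial : ℕ → Set
Monomial n = Subset n

evalMono : ∀ {n} → Monomial n → F2^ n → Bool
evalMono I x = Data.Vec.foldr _ _∧_ true (zipWith (λ b xi → not b ∨ xi) I x)

ANF : ℕ → Set
ANF n = List (Monomial n)

eval : ∀ {n} → ANF n → F2^ n → Bool
eval f x = foldr (λ m acc → evalMono m x xor acc) false f

deg : ∀ {n} → Monomial n → ℕ
deg I = ∣ I ∣

-- monomials pairwise distinct (so the list is really the ANF of f)
DistinctMonomials : ∀ {n} → ANF n → Set
DistinctMonomials f = Unique f

Homogeneous : ∀ {n} → ℕ → ANF n → Set
Homogeneous k f = All (λ m → deg m ≡ k) f

ZeroIntersecting : ∀ {n} → ANF n → Set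
ZeroIntersecting f = AllPairs (λ mi mj → Empty (mi ∩ mj)) f

sumOver : ∀ {n} → ANF n → List (F2^ n) → Bool
sumOver f U = foldr (λ x acc → eval f x xor acc) false U

N : ∀ {n} → ℕ → ANF n → List (List (F2^ n))
N {n} k f = filter (λ U → (isSubspaceOfDim k U ∧ sumOver f U) BoolP.≟ true) (subsetsF2 n)

Gprod : ℕ → ℕ → ℕ
Gprod k zero    = 1
Gprod k (suc j) = Gprod k j Data.Nat.* (2 ^ k ∸ 2 ^ j)

G : ℕ → ℕ
G k = Gprod k k

private
  GprodNZ : ∀ k j → j Data.Nat.≤ k → NonZero (Gprod k j)
  GprodNZ k zero    _   = _
  GprodNZ k (suc j) sj≤k =
    m*n≢0 (Gprod k j) (2 ^ k ∸ 2 ^ j)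
      {{GprodNZ k j (Data.Nat.Properties.≤-trans (Data.Nat.Properties.n≤1+n j) sj≤k)}}
      {{>-nonZero (m<n⇒0<n∸m (^-monoʳ-< 2 (s≤s (s≤s z≤n)) sj≤k))}}

G-nonZero : ∀ k → NonZero (G k)
G-nonZero k = GprodNZ k k Data.Nat.Properties.≤-refl

2G-nonZero : ∀ k → NonZero (2 Data.Nat.* G k)
2G-nonZero k = m*n≢0 2 (G k) {{_}} {{G-nonZero k}}

_^ℚ_ : ℚ → ℕ → ℚ
q ^ℚ zero  = 1ℚ
q ^ℚ suc t = q *ℚ (q ^ℚ t)

-- The right-hand side  2^{kn-1}/G · (1 − (1 − G/2^{k²−1})^t),
-- written as 2^{kn}/(2G) · (1 − (1 − 2G/2^{k²})^t)  (same rational number,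
-- avoids negative exponents when k = 0 or n = 0).
formula : (n k t : ℕ) → ℚ
formula n k t =
  (_/_ (+ (2 ^ (k Data.Nat.* n))) (2 Data.Nat.* G k) {{2G-nonZero k}})
    *ℚ (1ℚ - ((1ℚ - _/_ (+ (2 Data.Nat.* G k)) (2 ^ (k Data.Nat.* k)) {{m^n≢0 2 (k Data.Nat.* k)}}) ^ℚ t))

-- Encode a k-tuple of vectors of F₂ⁿ as an n×k matrix R, i.e. a linear map F₂ᵏ → F₂ⁿ, and put
-- S_f(R) = Σ_{c ∈ F₂ᵏ} f(Rc). A nonzero kernel vector of R pairs off the terms, so S_f(R) = 0 unless R
-- is injective, in which case S_f(R) is the sum of f over the subspace spanned by the columns of R.
-- Every k-dimensional subspace has exactly G ordered bases, hence |N_k(f)|·G = #{R : S_f(R) = 1}.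
-- For a monomial x_I with |I| = k, S_{x_I}(R) = 1 iff the k×k block of rows of R indexed by I is
-- invertible, which happens for a fraction G/2^{k²} of all R. Disjoint monomials read disjoint sets of
-- rows, so the events S_{m_i}(R) = 1 are independent, and the biases 1 − 2·Pr[S = 1] multiply along
-- S_f = Σ S_{m_i}: Pr[S_f(R) = 1] = (1 − (1 − 2G/2^{k²})^t)/2.

module Submission where

open import Algebra.Bundles using (CommutativeMonoid; CommutativeRing)
open import Data.Bool using (Bool; true; false; not; _∧_; _∨_; _xor_)
import Data.Bool.Properties as Bool
open import Data.Bool.ListAction using (all)
open import Data.Empty using (⊥-elim)
open import Data.Fin using (zero; suc)
open import Data.Fin.Subset using (Subset; ∣_∣; ∁; _∩_; Empty)
import Data.Fin.Subset.Properties as Subset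
import Data.Integer as ℤ
import Data.Integer.Properties as ℤ
open import Data.List using (List; []; _∷_; _++_; map; foldr; length; filter; cartesianProductWith)
import Data.List.Properties as List
open import Data.List.Relation.Unary.All as All using (All; []; _∷_)
import Data.List.Relation.Unary.All.Properties as All
open import Data.List.Relation.Unary.AllPairs using ([]; _∷_)
open import Data.Nat using (ℕ; zero; suc; _+_; _*_; _∸_; _^_) renaming (NonZero to NonZeroℕ)
import Data.Nat.Properties as ℕ
open import Data.Nat.ListAction using (sum)
open import Data.Nat.ListAction.Properties using (sum-++)
open import Data.Product using (Σ; _×_; _,_)
open import Data.Rational using (ℚ; _/_; 1ℚ; 1/_; NonZero)
  renaming (_+_ to _+ℚ_; _*_ to _*ℚ_; _-_ to _-ℚ_)
open import Data.Rational.Literals using (fromℤ)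
import Data.Rational.Properties as ℚ
open import Data.Rational.Solver using (module +-*-Solver)
import Data.Rational.Unnormalised as ℚᵘ
import Data.Rational.Unnormalised.Properties as ℚᵘ
open import Data.Vec using (Vec; []; _∷_; lookup; zipWith)
import Data.Vec as Vec
import Data.Vec.Properties as Vec
open import Function using (_∘_)
open import Relation.Binary.PropositionalEquality
open ≡-Reasoning
open import Relation.Nullary using (¬_; yes; no)
open import Relation.Nullary.Decidable using (Dec; does; dec-true; dec-false)

import Algebra.Properties.CommutativeSemigroup ℕ.+-commutativeSemigroup as ℕ+
import Algebra.Properties.CommutativeSemigroup ℕ.*-commutativeSemigroup as ℕ*
import Algebra.Properties.CommutativeSemigroup (CommutativeRing.+-commutativeSemigroup Bool.xor-∧-commutativeRing) as Xor
import Algebra.Properties.CommutativeSemigroup (CommutativeMonoid.commutativeSemigroup Bool.∧-commutativeMonoid) as ∧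

open import Defs

private variable
  A B C : Set
  n j k : ℕ

∑ : List A → (A → ℕ) → ℕ
∑ xs f = sum (map f xs)

syntax ∑ xs (λ x → e) = ∑[ x ∈ xs ] e

∑-cong : ∀ {f g : A → ℕ} → (∀ x → f x ≡ g x) → ∀ xs → ∑ xs f ≡ ∑ xs g
∑-cong f≗g []       = refl
∑-cong f≗g (x ∷ xs) = cong₂ _+_ (f≗g x) (∑-cong f≗g xs)

∑-cong-All : ∀ {P : A → Set} {f g : A → ℕ} {xs} → All P xs → (∀ {x} → P x → f x ≡ g x) → ∑ xs f ≡ ∑ xs g
∑-cong-All []         f≗g = refl
∑-cong-All (px ∷ pxs) f≗g = cong₂ _+_ (f≗g px) (∑-cong-All pxs f≗g)

∑-++ : ∀ (f : A → ℕ) xs ys → ∑ (xs ++ ys) f ≡ ∑ xs f + ∑ ys f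
∑-++ f xs ys = trans (cong sum (List.map-++ f xs ys)) (sum-++ (map f xs) (map f ys))

∑-map : ∀ (f : B → ℕ) (g : A → B) xs → ∑ (map g xs) f ≡ ∑ xs (f ∘ g)
∑-map f g xs = cong sum (sym (List.map-∘ xs))

∑-const : ∀ c (xs : List A) → ∑[ _ ∈ xs ] c ≡ length xs * c
∑-const c []       = refl
∑-const c (x ∷ xs) = cong (c +_) (∑-const c xs)

∑-+ : ∀ (f g : A → ℕ) xs → ∑[ x ∈ xs ] (f x + g x) ≡ ∑ xs f + ∑ xs g
∑-+ f g []       = refl
∑-+ f g (x ∷ xs) = trans (cong (f x + g x +_) (∑-+ f g xs)) (ℕ+.interchange (f x) (g x) (∑ xs f) (∑ xs g))

∑-*ˡ : ∀ c (f : A → ℕ) xs → ∑[ x ∈ xs ] (c * f x) ≡ c * ∑ xs f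
∑-*ˡ c f []       = sym (ℕ.*-zeroʳ c)
∑-*ˡ c f (x ∷ xs) = trans (cong (c * f x +_) (∑-*ˡ c f xs)) (sym (ℕ.*-distribˡ-+ c (f x) (∑ xs f)))

∑-*ʳ : ∀ c (f : A → ℕ) xs → ∑[ x ∈ xs ] (f x * c) ≡ ∑ xs f * c
∑-*ʳ c f xs = begin
  ∑[ x ∈ xs ] (f x * c) ≡⟨ ∑-cong (λ x → ℕ.*-comm (f x) c) xs ⟩
  ∑[ x ∈ xs ] (c * f x) ≡⟨ ∑-*ˡ c f xs ⟩
  c * ∑ xs f            ≡⟨ ℕ.*-comm c _ ⟩
  ∑ xs f * c            ∎

∑-swap : ∀ (F : A → B → ℕ) xs ys → ∑[ x ∈ xs ] ∑[ y ∈ ys ] F x y ≡ ∑[ y ∈ ys ] ∑[ x ∈ xs ] F x y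
∑-swap F []       ys = sym (trans (∑-const 0 ys) (ℕ.*-zeroʳ (length ys)))
∑-swap F (x ∷ xs) ys = trans (cong (∑ ys (F x) +_) (∑-swap F xs ys)) (sym (∑-+ (F x) _ ys))

∑-cartesianProductWith : ∀ (f : C → ℕ) (g : A → B → C) xs ys →
  ∑ (cartesianProductWith g xs ys) f ≡ ∑[ x ∈ xs ] ∑[ y ∈ ys ] f (g x y)
∑-cartesianProductWith f g []       ys = refl
∑-cartesianProductWith f g (x ∷ xs) ys = begin
  ∑ (map (g x) ys ++ cartesianProductWith g xs ys) f
    ≡⟨ ∑-++ f (map (g x) ys) _ ⟩
  ∑ (map (g x) ys) f + ∑ (cartesianProductWith g xs ys) f
    ≡⟨ cong₂ _+_ (∑-map f (g x) ys) (∑-cartesianProductWith f g xs ys) ⟩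
  ∑[ y ∈ ys ] f (g x y) + ∑[ x ∈ xs ] ∑[ y ∈ ys ] f (g x y) ∎

𝟙 : Bool → ℕ
𝟙 true  = 1
𝟙 false = 0

count : (A → Bool) → List A → ℕ
count p xs = ∑[ x ∈ xs ] 𝟙 (p x)

count-cong : ∀ {p q : A → Bool} → (∀ x → p x ≡ q x) → ∀ xs → count p xs ≡ count q xs
count-cong p≗q = ∑-cong (cong 𝟙 ∘ p≗q)

count-false : ∀ (xs : List A) → count (λ _ → false) xs ≡ 0
count-false xs = trans (∑-const 0 xs) (ℕ.*-zeroʳ (length xs))

count-true : ∀ (xs : List A) → count (λ _ → true) xs ≡ length xs
count-true xs = trans (∑-const 1 xs) (ℕ.*-identityʳ (length xs))

count-∧ˡ : ∀ b (p : A → Bool) xs → count (λ x → b ∧ p x) xs ≡ 𝟙 b * count p xs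
count-∧ˡ true  p xs = sym (ℕ.+-identityʳ _)
count-∧ˡ false p xs = count-false xs

𝟙-split : ∀ a b → 𝟙 a ≡ 𝟙 (a ∧ b) + 𝟙 (a ∧ not b)
𝟙-split true  true  = refl
𝟙-split true  false = refl
𝟙-split false _     = refl

count-split : ∀ (p q : A → Bool) xs → count q xs ≡ count (λ x → q x ∧ p x) xs + count (λ x → q x ∧ not (p x)) xs
count-split p q xs = trans (∑-cong (λ x → 𝟙-split (q x) (p x)) xs) (∑-+ (λ x → 𝟙 (q x ∧ p x)) _ xs)

count+count-not : ∀ (p : A → Bool) xs → count p xs + count (not ∘ p) xs ≡ length xs
count+count-not p xs = trans (sym (count-split p (λ _ → true) xs)) (count-true xs)

count≡0⇒All-false : ∀ (p : A → Bool) xs → count p xs ≡ 0 → All (λ x → p x ≡ false) xs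
count≡0⇒All-false p []       _ = []
count≡0⇒All-false p (x ∷ xs) e with p x in px
... | false = px ∷ count≡0⇒All-false p xs e

length-filter : ∀ (p : A → Bool) xs → length (filter (λ x → p x Bool.≟ true) xs) ≡ count p xs
length-filter p []       = refl
length-filter p (x ∷ xs) with p x
... | true  = cong suc (length-filter p xs)
... | false = length-filter p xs

length≡∑1 : ∀ (xs : List A) → length xs ≡ ∑[ _ ∈ xs ] 1
length≡∑1 xs = sym (count-true xs)

length-cartesianProductWith : ∀ (c : A → B → C) xs ys → length (cartesianProductWith c xs ys) ≡ length xs * length ys
length-cartesianProductWith c xs ys = begin
  length (cartesianProductWith c xs ys)  ≡⟨ length≡∑1 (cartesianProductWith c xs ys) ⟩
  ∑[ _ ∈ cartesianProductWith c xs ys ] 1 ≡⟨ ∑-cartesianProductWith (λ _ → 1) c xs ys ⟩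
  ∑[ _ ∈ xs ] ∑[ _ ∈ ys ] 1               ≡⟨ ∑-cong (λ _ → sym (length≡∑1 ys)) xs ⟩
  ∑[ _ ∈ xs ] length ys                   ≡⟨ ∑-const _ xs ⟩
  length xs * length ys                   ∎

does⇒ : ∀ {P : Set} (P? : Dec P) → does P? ≡ true → P
does⇒ (yes p) _  = p
does⇒ (no _)  ()

_≡ᵇ_ : Bool → Bool → Bool
a ≡ᵇ b = does (a Bool.≟ b)

≡ᵇ⇒≡ : ∀ a b → a ≡ᵇ b ≡ true → a ≡ b
≡ᵇ⇒≡ a b = does⇒ (a Bool.≟ b)

∧-congˡ-true : ∀ {a b c} → (a ≡ true → b ≡ c) → a ∧ b ≡ a ∧ c
∧-congˡ-true {false} _   = refl
∧-congˡ-true {true}  b≡c = b≡c refl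

all-++ : ∀ (p : A → Bool) xs ys → all p (xs ++ ys) ≡ all p xs ∧ all p ys
all-++ p []       ys = refl
all-++ p (x ∷ xs) ys = trans (cong (p x ∧_) (all-++ p xs ys)) (sym (Bool.∧-assoc (p x) _ _))

all-map : ∀ (p : B → Bool) (h : A → B) xs → all p (map h xs) ≡ all (p ∘ h) xs
all-map p h []       = refl
all-map p h (x ∷ xs) = cong (p (h x) ∧_) (all-map p h xs)

all-cong : ∀ {p q : A → Bool} → (∀ x → p x ≡ q x) → ∀ xs → all p xs ≡ all q xs
all-cong p≗q []       = refl
all-cong p≗q (x ∷ xs) = cong₂ _∧_ (p≗q x) (all-cong p≗q xs)

all≡false⇒∃ : ∀ (p : A → Bool) xs → all p xs ≡ false → Σ A λ x → p x ≡ false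
all≡false⇒∃ p (x ∷ xs) all-p with p x in px
... | false = x , px
... | true  = all≡false⇒∃ p xs all-p

parity : ℕ → Bool
parity zero    = false
parity (suc n) = not (parity n)

parity-+ : ∀ m n → parity (m + n) ≡ parity m xor parity n
parity-+ zero    n = refl
parity-+ (suc m) n = trans (cong not (parity-+ m n)) (Bool.not-distribˡ-xor (parity m) (parity n))

parity-double : ∀ m → parity (m + m) ≡ false
parity-double m = trans (parity-+ m m) (Bool.xor-same (parity m))

-- Defs.sumOver f U unfolds to ⨁ U (eval f).
⨁ : List A → (A → Bool) → Bool
⨁ xs p = foldr (λ x acc → p x xor acc) false xs

syntax ⨁ xs (λ x → e) = ⨁[ x ∈ xs ] e

⨁≡parity∘count : ∀ (p : A → Bool) xs → ⨁ xs p ≡ parity (count p xs)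
⨁≡parity∘count p []       = refl
⨁≡parity∘count p (x ∷ xs) = trans (cong (p x xor_) (⨁≡parity∘count p xs)) (sym (parity-𝟙+ (p x)))
  where
  parity-𝟙+ : ∀ b → parity (𝟙 b + count p xs) ≡ b xor parity (count p xs)
  parity-𝟙+ true  = refl
  parity-𝟙+ false = refl

⨁-cong : ∀ {p q : A → Bool} → (∀ x → p x ≡ q x) → ∀ xs → ⨁ xs p ≡ ⨁ xs q
⨁-cong p≗q []       = refl
⨁-cong p≗q (x ∷ xs) = cong₂ _xor_ (p≗q x) (⨁-cong p≗q xs)

⨁-map : ∀ (p : B → Bool) (g : A → B) xs → ⨁ (map g xs) p ≡ ⨁ xs (p ∘ g)
⨁-map p g []       = refl
⨁-map p g (x ∷ xs) = cong (p (g x) xor_) (⨁-map p g xs)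

⨁-xor : ∀ (p q : A → Bool) xs → ⨁[ x ∈ xs ] (p x xor q x) ≡ ⨁ xs p xor ⨁ xs q
⨁-xor p q []       = refl
⨁-xor p q (x ∷ xs) = trans (cong ((p x xor q x) xor_) (⨁-xor p q xs)) (Xor.interchange (p x) (q x) (⨁ xs p) (⨁ xs q))

⨁-false : ∀ (xs : List A) → ⨁[ _ ∈ xs ] false ≡ false
⨁-false []       = refl
⨁-false (x ∷ xs) = ⨁-false xs

-- Independent events for the uniform distribution on vectors

vectorsOver : List A → (n : ℕ) → List (Vec A n)
vectorsOver xs zero    = [] ∷ []
vectorsOver xs (suc n) = cartesianProductWith _∷_ xs (vectorsOver xs n)

∑-vectorsOver-suc : ∀ (F : Vec A (suc n) → ℕ) xs →
  ∑ (vectorsOver xs (suc n)) F ≡ ∑[ x ∈ xs ] ∑[ v ∈ vectorsOver xs n ] F (x ∷ v)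
∑-vectorsOver-suc F xs = ∑-cartesianProductWith F _∷_ xs _

length-vectorsOver : ∀ (xs : List A) n → length (vectorsOver xs n) ≡ length xs ^ n
length-vectorsOver xs zero    = refl
length-vectorsOver xs (suc n) =
  trans (length-cartesianProductWith _∷_ xs (vectorsOver xs n)) (cong (length xs *_) (length-vectorsOver xs n))

select : (S : Subset n) → Vec A n → Vec A ∣ S ∣
select []          []      = []
select (true ∷ S)  (x ∷ v) = x ∷ select S v
select (false ∷ S) (x ∷ v) = select S v

-- Selecting the rows in S pushes the uniform distribution on Aⁿ forward to the uniform one on A^∣S∣.
∑-select : ∀ (xs : List A) (S : Subset n) (F : Vec A ∣ S ∣ → ℕ) →
  (∑[ v ∈ vectorsOver xs n ] F (select S v)) * length xs ^ ∣ S ∣ ≡ length xs ^ n * ∑ (vectorsOver xs ∣ S ∣) F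
∑-select xs [] F = ℕ.*-comm _ 1
∑-select {n = suc n} xs (true ∷ S) F = begin
  (∑[ v ∈ vectorsOver xs (suc n) ] F (select (true ∷ S) v)) * (K * K ^ ∣ S ∣)
    ≡⟨ cong (_* (K * K ^ ∣ S ∣)) (∑-vectorsOver-suc (F ∘ select (true ∷ S)) xs) ⟩
  (∑[ x ∈ xs ] ∑[ v ∈ vectorsOver xs n ] F (x ∷ select S v)) * (K * K ^ ∣ S ∣)
    ≡⟨ ℕ*.x∙yz≈y∙xz (∑[ x ∈ xs ] ∑[ v ∈ vectorsOver xs n ] F (x ∷ select S v)) K (K ^ ∣ S ∣) ⟩
  K * ((∑[ x ∈ xs ] ∑[ v ∈ vectorsOver xs n ] F (x ∷ select S v)) * K ^ ∣ S ∣)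
    ≡⟨ cong (K *_) (sym (∑-*ʳ (K ^ ∣ S ∣) _ xs)) ⟩
  K * ∑[ x ∈ xs ] ((∑[ v ∈ vectorsOver xs n ] F (x ∷ select S v)) * K ^ ∣ S ∣)
    ≡⟨ cong (K *_) (∑-cong (λ x → ∑-select xs S (F ∘ (x ∷_))) xs) ⟩
  K * ∑[ x ∈ xs ] (K ^ n * ∑[ w ∈ vectorsOver xs ∣ S ∣ ] F (x ∷ w))
    ≡⟨ cong (K *_) (∑-*ˡ (K ^ n) _ xs) ⟩
  K * (K ^ n * ∑[ x ∈ xs ] ∑[ w ∈ vectorsOver xs ∣ S ∣ ] F (x ∷ w))
    ≡⟨ sym (ℕ.*-assoc K (K ^ n) _) ⟩
  K * K ^ n * ∑[ x ∈ xs ] ∑[ w ∈ vectorsOver xs ∣ S ∣ ] F (x ∷ w)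
    ≡⟨ cong (K * K ^ n *_) (sym (∑-vectorsOver-suc F xs)) ⟩
  K * K ^ n * ∑ (vectorsOver xs (suc ∣ S ∣)) F ∎
  where
  K : ℕ
  K = length xs
∑-select {n = suc n} xs (false ∷ S) F = begin
  (∑[ v ∈ vectorsOver xs (suc n) ] F (select (false ∷ S) v)) * K ^ ∣ S ∣
    ≡⟨ cong (_* K ^ ∣ S ∣) (∑-vectorsOver-suc (F ∘ select (false ∷ S)) xs) ⟩
  (∑[ _ ∈ xs ] ∑[ v ∈ vectorsOver xs n ] F (select S v)) * K ^ ∣ S ∣
    ≡⟨ cong (_* K ^ ∣ S ∣) (∑-const _ xs) ⟩
  K * (∑[ v ∈ vectorsOver xs n ] F (select S v)) * K ^ ∣ S ∣
    ≡⟨ ℕ.*-assoc K _ _ ⟩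
  K * ((∑[ v ∈ vectorsOver xs n ] F (select S v)) * K ^ ∣ S ∣)
    ≡⟨ cong (K *_) (∑-select xs S F) ⟩
  K * (K ^ n * ∑ (vectorsOver xs ∣ S ∣) F)
    ≡⟨ sym (ℕ.*-assoc K (K ^ n) _) ⟩
  K * K ^ n * ∑ (vectorsOver xs ∣ S ∣) F ∎
  where
  K : ℕ
  K = length xs

Independent : List A → (A → Bool) → (A → Bool) → Set
Independent L g h = length L * count (λ x → g x ∧ h x) L ≡ count g L * count h L

Independent-sym : ∀ {L : List A} {g h} → Independent L g h → Independent L h g
Independent-sym {L = L} {g} {h} g⊥h = begin
  length L * count (λ x → h x ∧ g x) L ≡⟨ cong (length L *_) (count-cong (λ x → Bool.∧-comm (h x) (g x)) L) ⟩
  length L * count (λ x → g x ∧ h x) L ≡⟨ g⊥h ⟩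
  count g L * count h L                ≡⟨ ℕ.*-comm (count g L) _ ⟩
  count h L * count g L                ∎

Independent-cartesianProductWith : ∀ (c : A → B → C) xs ys {g h : C → Bool} (h₀ : B → Bool) →
  (∀ x y → h (c x y) ≡ h₀ y) → (∀ x → Independent ys (λ y → g (c x y)) h₀) →
  Independent (cartesianProductWith c xs ys) g h
Independent-cartesianProductWith {A = A} {C = C} c xs ys {g} {h} h₀ h≡h₀ g⊥h = begin
  length P * count (λ z → g z ∧ h z) P
    ≡⟨ cong₂ _*_ (length-cartesianProductWith c xs ys) (∑-cartesianProductWith _ c xs ys) ⟩
  K * M * ∑[ x ∈ xs ] ∑[ y ∈ ys ] 𝟙 (g (c x y) ∧ h (c x y))
    ≡⟨ cong (K * M *_) (∑-cong (λ x → count-cong (λ y → cong (g (c x y) ∧_) (h≡h₀ x y)) ys) xs) ⟩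
  K * M * ∑[ x ∈ xs ] a∧h₀ x
    ≡⟨ ℕ.*-assoc K M _ ⟩
  K * (M * ∑[ x ∈ xs ] a∧h₀ x)
    ≡⟨ cong (K *_) (sym (∑-*ˡ M a∧h₀ xs)) ⟩
  K * ∑[ x ∈ xs ] (M * a∧h₀ x)
    ≡⟨ cong (K *_) (∑-cong g⊥h xs) ⟩
  K * ∑[ x ∈ xs ] (a x * b)
    ≡⟨ cong (K *_) (∑-*ʳ b a xs) ⟩
  K * (∑ xs a * b)
    ≡⟨ ℕ*.x∙yz≈y∙xz K (∑ xs a) b ⟩
  ∑ xs a * (K * b)
    ≡⟨ cong₂ _*_ (sym (∑-cartesianProductWith _ c xs ys)) (sym count-h) ⟩
  count g P * count h P ∎
  where
  P : List C
  P = cartesianProductWith c xs ys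
  K M b : ℕ
  K = length xs
  M = length ys
  b = count h₀ ys
  a a∧h₀ : A → ℕ
  a x = count (λ y → g (c x y)) ys
  a∧h₀ x = count (λ y → g (c x y) ∧ h₀ y) ys
  count-h : count h P ≡ K * b
  count-h = begin
    count h P                          ≡⟨ ∑-cartesianProductWith _ c xs ys ⟩
    ∑[ x ∈ xs ] count (h ∘ c x) ys     ≡⟨ ∑-cong (λ x → count-cong (h≡h₀ x) ys) xs ⟩
    ∑[ _ ∈ xs ] b                      ≡⟨ ∑-const b xs ⟩
    K * b                              ∎

AgreeOn : Subset n → Vec A n → Vec A n → Set
AgreeOn S u v = ∀ i → lookup S i ≡ true → lookup u i ≡ lookup v i

DependsOnlyOn : Subset n → (Vec A n → B) → Set
DependsOnlyOn S g = ∀ u v → AgreeOn S u v → g u ≡ g v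

DependsOnlyOn-tail : ∀ {b} {S : Subset n} {g : Vec A (suc n) → B} →
  DependsOnlyOn (b ∷ S) g → ∀ x → DependsOnlyOn S (g ∘ (x ∷_))
DependsOnlyOn-tail dep x u v agree = dep (x ∷ u) (x ∷ v) λ { zero _ → refl ; (suc i) i∈S → agree i i∈S }

DependsOnlyOn-head : ∀ {S : Subset n} {g : Vec A (suc n) → B} →
  DependsOnlyOn (false ∷ S) g → ∀ x y v → g (x ∷ v) ≡ g (y ∷ v)
DependsOnlyOn-head dep x y v = dep (x ∷ v) (y ∷ v) λ { zero () ; (suc i) _ → refl }

DependsOnlyOn-not : ∀ {S : Subset n} {g : Vec A n → Bool} → DependsOnlyOn S g → DependsOnlyOn S (not ∘ g)
DependsOnlyOn-not dep u v agree = cong not (dep u v agree)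

Independent-vectorsOver : ∀ (xs : List A) (S : Subset n) {g h : Vec A n → Bool} →
  DependsOnlyOn S g → DependsOnlyOn (∁ S) h → Independent (vectorsOver xs n) g h
Independent-vectorsOver xs []          {g} {h} _ _ with g [] | h []
... | true  | true  = refl
... | true  | false = refl
... | false | _     = refl
Independent-vectorsOver []         (_ ∷ _) _ _ = refl
Independent-vectorsOver {n = suc n} xs@(x₀ ∷ _) (true ∷ S) {g} {h} dg dh =
  Independent-cartesianProductWith _∷_ xs (vectorsOver xs n) {g} {h} (λ v → h (x₀ ∷ v))
    (λ x v → DependsOnlyOn-head dh x x₀ v)
    (λ x → Independent-vectorsOver xs S (DependsOnlyOn-tail dg x) (DependsOnlyOn-tail dh x₀))
Independent-vectorsOver {n = suc n} xs@(x₀ ∷ _) (false ∷ S) {g} {h} dg dh =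
  Independent-sym {L = vectorsOver xs (suc n)} {g = h} {h = g}
    (Independent-cartesianProductWith _∷_ xs (vectorsOver xs n) {h} {g} (λ v → g (x₀ ∷ v))
      (λ x v → DependsOnlyOn-head dg x x₀ v)
      (λ x → Independent-sym {L = vectorsOver xs n} {g = λ v → g (x₀ ∷ v)} {h = λ v → h (x ∷ v)}
               (Independent-vectorsOver xs S (DependsOnlyOn-tail dg x₀) (DependsOnlyOn-tail dh x))))

count-xor : ∀ (L : List A) (g h : A → Bool) → Independent L g (not ∘ h) → Independent L (not ∘ g) h →
  length L * count (λ x → g x xor h x) L ≡ count g L * count (not ∘ h) L + count (not ∘ g) L * count h L
count-xor L g h g⊥¬h ¬g⊥h = begin
  length L * count (λ x → g x xor h x) L
    ≡⟨ cong (length L *_) (trans (∑-cong (λ x → 𝟙-xor (g x) (h x)) L) (∑-+ (λ x → 𝟙 (g x ∧ not (h x))) _ L)) ⟩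
  length L * (count (λ x → g x ∧ not (h x)) L + count (λ x → not (g x) ∧ h x) L)
    ≡⟨ ℕ.*-distribˡ-+ (length L) _ _ ⟩
  length L * count (λ x → g x ∧ not (h x)) L + length L * count (λ x → not (g x) ∧ h x) L
    ≡⟨ cong₂ _+_ g⊥¬h ¬g⊥h ⟩
  count g L * count (not ∘ h) L + count (not ∘ g) L * count h L ∎
  where
  𝟙-xor : ∀ a b → 𝟙 (a xor b) ≡ 𝟙 (a ∧ not b) + 𝟙 (not a ∧ b)
  𝟙-xor true  true  = refl
  𝟙-xor true  false = refl
  𝟙-xor false true  = refl
  𝟙-xor false false = refl

==-refl : (u : F2^ n) → u == u ≡ true
==-refl u = dec-true (Vec.≡-dec Bool._≟_ u u) refl

==⇒≡ : (u v : F2^ n) → u == v ≡ true → u ≡ v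
==⇒≡ u v = does⇒ (Vec.≡-dec Bool._≟_ u v)

≢⇒==-false : {u v : F2^ n} → ¬ u ≡ v → u == v ≡ false
≢⇒==-false {u = u} {v} = dec-false (Vec.≡-dec Bool._≟_ u v)

==-comm : (u v : F2^ n) → u == v ≡ v == u
==-comm u v with Vec.≡-dec Bool._≟_ u v
... | yes u≡v = sym (dec-true (Vec.≡-dec Bool._≟_ v u) (sym u≡v))
... | no u≢v  = sym (dec-false (Vec.≡-dec Bool._≟_ v u) (u≢v ∘ sym))

==-∷ : ∀ b (u v : F2^ n) → (b ∷ u) == (b ∷ v) ≡ u == v
==-∷ false u v = refl
==-∷ true  u v = refl

⊕-comm : (u v : F2^ n) → u ⊕ v ≡ v ⊕ u
⊕-comm = Vec.zipWith-comm Bool.xor-comm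

⊕-assoc : (u v w : F2^ n) → (u ⊕ v) ⊕ w ≡ u ⊕ (v ⊕ w)
⊕-assoc = Vec.zipWith-assoc Bool.xor-assoc

⊕-identityʳ : (u : F2^ n) → u ⊕ zeroVec ≡ u
⊕-identityʳ = Vec.zipWith-identityʳ Bool.xor-identityʳ

⊕-self : (u : F2^ n) → u ⊕ u ≡ zeroVec
⊕-self []      = refl
⊕-self (a ∷ u) = cong₂ _∷_ (Bool.xor-same a) (⊕-self u)

⊕-cancelʳ : (u v : F2^ n) → (u ⊕ v) ⊕ v ≡ u
⊕-cancelʳ u v = trans (⊕-assoc u v v) (trans (cong (u ⊕_) (⊕-self v)) (⊕-identityʳ u))

⊕≡zero⇒≡ : {u v : F2^ n} → u ⊕ v ≡ zeroVec → u ≡ v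
⊕≡zero⇒≡ {u = u} {v} e = trans (sym (⊕-cancelʳ u v)) (trans (cong (_⊕ v) e) (trans (⊕-comm zeroVec v) (⊕-identityʳ v)))

⊕==zero : (u v : F2^ n) → (u ⊕ v) == zeroVec ≡ u == v
⊕==zero u v with Vec.≡-dec Bool._≟_ u v
... | yes refl = dec-true (Vec.≡-dec Bool._≟_ _ _) (⊕-self u)
... | no u≢v   = dec-false (Vec.≡-dec Bool._≟_ _ _) (u≢v ∘ ⊕≡zero⇒≡)

∈ᵇ-here : (x : F2^ n) (L : List (F2^ n)) → x ∈ᵇ (x ∷ L) ≡ true
∈ᵇ-here x L = cong (_∨ (x ∈ᵇ L)) (==-refl x)

∈ᵇ-there : (v x : F2^ n) (L : List (F2^ n)) → v ∈ᵇ L ≡ true → v ∈ᵇ (x ∷ L) ≡ true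
∈ᵇ-there v x L v∈L = trans (cong ((v == x) ∨_) v∈L) (Bool.∨-zeroʳ (v == x))

∈ᵇ-++ : (v : F2^ n) (xs ys : List (F2^ n)) → v ∈ᵇ (xs ++ ys) ≡ (v ∈ᵇ xs) ∨ (v ∈ᵇ ys)
∈ᵇ-++ v []       ys = refl
∈ᵇ-++ v (x ∷ xs) ys = trans (cong ((v == x) ∨_) (∈ᵇ-++ v xs ys)) (sym (Bool.∨-assoc (v == x) _ _))

∈ᵇ-map⁺ : ∀ {m} (h : F2^ m → F2^ n) x L → x ∈ᵇ L ≡ true → h x ∈ᵇ map h L ≡ true
∈ᵇ-map⁺ h x (y ∷ L) x∈ with x == y in x=y
... | true  = subst (λ z → h z ∈ᵇ map h (y ∷ L) ≡ true) (sym (==⇒≡ x y x=y)) (∈ᵇ-here (h y) (map h L))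
... | false = ∈ᵇ-there (h x) (h y) (map h L) (∈ᵇ-map⁺ h x L x∈)

∈ᵇ-map⁻ : ∀ {m} (h : F2^ m → F2^ n) v L → v ∈ᵇ map h L ≡ true → Σ (F2^ m) λ x → (x ∈ᵇ L ≡ true) × (v ≡ h x)
∈ᵇ-map⁻ h v (x ∷ L) v∈ with v == h x in v=hx
... | true  = x , ∈ᵇ-here x L , ==⇒≡ v (h x) v=hx
... | false with ∈ᵇ-map⁻ h v L v∈
...   | y , y∈L , v≡hy = y , ∈ᵇ-there y x L y∈L , v≡hy

∉ᵇ-map⁺ : ∀ {m} (h : F2^ m → F2^ n) → (∀ {a b} → h a ≡ h b → a ≡ b) →
  ∀ x L → x ∈ᵇ L ≡ false → h x ∈ᵇ map h L ≡ false
∉ᵇ-map⁺ h inj x L x∉ with h x ∈ᵇ map h L in hx∈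
... | false = refl
... | true with ∈ᵇ-map⁻ h (h x) L hx∈
...   | y , y∈L , hx≡hy = trans (sym (subst (λ z → z ∈ᵇ L ≡ true) (sym (inj hx≡hy)) y∈L)) x∉

all⇒∈ᵇ⇒ : ∀ {p : F2^ n → Bool} {v} L → all p L ≡ true → v ∈ᵇ L ≡ true → p v ≡ true
all⇒∈ᵇ⇒ {p = p} {v} (x ∷ L) all-p v∈ with v == x in v=x
... | true  = subst (λ y → p y ≡ true) (sym (==⇒≡ v x v=x)) (Bool.∧-conicalˡ (p x) _ all-p)
... | false = all⇒∈ᵇ⇒ L (Bool.∧-conicalʳ (p x) _ all-p) v∈

∈ᵇ⇒all : ∀ {p : F2^ n → Bool} L → (∀ v → v ∈ᵇ L ≡ true → p v ≡ true) → all p L ≡ true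
∈ᵇ⇒all []      _   = refl
∈ᵇ⇒all (x ∷ L) ∈⇒p = cong₂ _∧_ (∈⇒p x (∈ᵇ-here x L)) (∈ᵇ⇒all L (λ v → ∈⇒p v ∘ ∈ᵇ-there v x L))

all-cong-∈ᵇ : ∀ {p q : F2^ n → Bool} L → (∀ v → v ∈ᵇ L ≡ true → p v ≡ q v) → all p L ≡ all q L
all-cong-∈ᵇ []      _     = refl
all-cong-∈ᵇ (x ∷ L) ∈⇒p≡q =
  cong₂ _∧_ (∈⇒p≡q x (∈ᵇ-here x L)) (all-cong-∈ᵇ L (λ v → ∈⇒p≡q v ∘ ∈ᵇ-there v x L))

all-≢⇒∉ᵇ : ∀ {m} (v : F2^ n) (h : F2^ m → F2^ n) xs → all (λ c → not (v == h c)) xs ≡ not (v ∈ᵇ map h xs)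
all-≢⇒∉ᵇ v h []       = refl
all-≢⇒∉ᵇ v h (x ∷ xs) with v == h x
... | true  = refl
... | false = all-≢⇒∉ᵇ v h xs

length-allVecs : ∀ n → length (allVecs n) ≡ 2 ^ n
length-allVecs zero    = refl
length-allVecs (suc n) = begin
  length (map (false ∷_) (allVecs n) ++ map (true ∷_) (allVecs n))
    ≡⟨ List.length-++ (map (false ∷_) (allVecs n)) ⟩
  length (map (false ∷_) (allVecs n)) + length (map (true ∷_) (allVecs n))
    ≡⟨ cong₂ _+_ (List.length-map (false ∷_) (allVecs n)) (List.length-map (true ∷_) (allVecs n)) ⟩
  length (allVecs n) + length (allVecs n)
    ≡⟨ cong (λ m → m + m) (length-allVecs n) ⟩
  2 ^ n + 2 ^ n
    ≡⟨ cong (2 ^ n +_) (sym (ℕ.+-identityʳ (2 ^ n))) ⟩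
  2 ^ suc n ∎

∑-allVecs-suc : ∀ n (F : F2^ (suc n) → ℕ) →
  ∑ (allVecs (suc n)) F ≡ ∑ (allVecs n) (F ∘ (false ∷_)) + ∑ (allVecs n) (F ∘ (true ∷_))
∑-allVecs-suc n F =
  trans (∑-++ F (map (false ∷_) (allVecs n)) _) (cong₂ _+_ (∑-map F _ (allVecs n)) (∑-map F _ (allVecs n)))

∈ᵇ-allVecs : (v : F2^ n) → v ∈ᵇ allVecs n ≡ true
∈ᵇ-allVecs []           = refl
∈ᵇ-allVecs {suc n} (b ∷ v) = begin
  (b ∷ v) ∈ᵇ allVecs (suc n)
    ≡⟨ ∈ᵇ-++ (b ∷ v) (map (false ∷_) (allVecs n)) _ ⟩
  ((b ∷ v) ∈ᵇ map (false ∷_) (allVecs n)) ∨ ((b ∷ v) ∈ᵇ map (true ∷_) (allVecs n))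
    ≡⟨ half b ⟩
  true ∎
  where
  half : ∀ b → ((b ∷ v) ∈ᵇ map (false ∷_) (allVecs n)) ∨ ((b ∷ v) ∈ᵇ map (true ∷_) (allVecs n)) ≡ true
  half false = cong (_∨ ((false ∷ v) ∈ᵇ map (true ∷_) (allVecs n))) (∈ᵇ-map⁺ (false ∷_) v (allVecs n) (∈ᵇ-allVecs v))
  half true  = trans (cong (((true ∷ v) ∈ᵇ map (false ∷_) (allVecs n)) ∨_) (∈ᵇ-map⁺ (true ∷_) v (allVecs n) (∈ᵇ-allVecs v)))
                     (Bool.∨-zeroʳ _)

All-allVecs : ∀ {P : F2^ n → Set} → All P (allVecs n) → ∀ v → P v
All-allVecs {zero} (P[] ∷ []) [] = P[]
All-allVecs {suc n} Ps (false ∷ v) = All-allVecs (All.map⁻ (All.++⁻ˡ (map (false ∷_) (allVecs n)) Ps)) v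
All-allVecs {suc n} Ps (true ∷ v)  = All-allVecs (All.map⁻ (All.++⁻ʳ (map (false ∷_) (allVecs n)) Ps)) v

all-allVecs : ∀ {p : F2^ n → Bool} → all p (allVecs n) ≡ true → ∀ v → p v ≡ true
all-allVecs {n} all-p v = all⇒∈ᵇ⇒ (allVecs n) all-p (∈ᵇ-allVecs v)

all-allVecs-suc : ∀ (p : F2^ (suc n) → Bool) →
  all p (allVecs (suc n)) ≡ all (p ∘ (false ∷_)) (allVecs n) ∧ all (p ∘ (true ∷_)) (allVecs n)
all-allVecs-suc {n} p =
  trans (all-++ p (map (false ∷_) (allVecs n)) _) (cong₂ _∧_ (all-map p _ (allVecs n)) (all-map p _ (allVecs n)))

∑-⊕-invariant : ∀ (w : F2^ n) (F : F2^ n → ℕ) → ∑[ c ∈ allVecs n ] F (c ⊕ w) ≡ ∑ (allVecs n) F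
∑-⊕-invariant []              F = refl
∑-⊕-invariant {suc n} (b ∷ w) F = begin
  ∑[ c ∈ allVecs (suc n) ] F (c ⊕ (b ∷ w))
    ≡⟨ ∑-allVecs-suc n (λ c → F (c ⊕ (b ∷ w))) ⟩
  ∑[ c ∈ allVecs n ] F (b ∷ (c ⊕ w)) + ∑[ c ∈ allVecs n ] F (not b ∷ (c ⊕ w))
    ≡⟨ cong₂ _+_ (∑-⊕-invariant w (F ∘ (b ∷_))) (∑-⊕-invariant w (F ∘ (not b ∷_))) ⟩
  ∑ (allVecs n) (F ∘ (b ∷_)) + ∑ (allVecs n) (F ∘ (not b ∷_))
    ≡⟨ halves b ⟩
  ∑ (allVecs n) (F ∘ (false ∷_)) + ∑ (allVecs n) (F ∘ (true ∷_))
    ≡⟨ sym (∑-allVecs-suc n F) ⟩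
  ∑ (allVecs (suc n)) F ∎
  where
  halves : ∀ b → ∑ (allVecs n) (F ∘ (b ∷_)) + ∑ (allVecs n) (F ∘ (not b ∷_))
               ≡ ∑ (allVecs n) (F ∘ (false ∷_)) + ∑ (allVecs n) (F ∘ (true ∷_))
  halves false = refl
  halves true  = ℕ.+-comm (∑ (allVecs n) (F ∘ (true ∷_))) _

⊕-invariant⇒count-even : ∀ {w : F2^ n} → ¬ w ≡ zeroVec → ∀ (g : F2^ n → Bool) → (∀ c → g (c ⊕ w) ≡ g c) →
  parity (count g (allVecs n)) ≡ false
⊕-invariant⇒count-even {w = []} w≢0 g inv = ⊥-elim (w≢0 refl)
⊕-invariant⇒count-even {suc n} {w = true ∷ w} w≢0 g inv = begin
  parity (count g (allVecs (suc n)))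
    ≡⟨ cong parity (∑-allVecs-suc n (𝟙 ∘ g)) ⟩
  parity (count (g ∘ (false ∷_)) (allVecs n) + count (g ∘ (true ∷_)) (allVecs n))
    ≡⟨ cong (λ m → parity (count (g ∘ (false ∷_)) (allVecs n) + m)) true-half ⟩
  parity (count (g ∘ (false ∷_)) (allVecs n) + count (g ∘ (false ∷_)) (allVecs n))
    ≡⟨ parity-double (count (g ∘ (false ∷_)) (allVecs n)) ⟩
  false ∎
  where
  true-half : count (g ∘ (true ∷_)) (allVecs n) ≡ count (g ∘ (false ∷_)) (allVecs n)
  true-half = begin
    count (g ∘ (true ∷_)) (allVecs n)                    ≡⟨ sym (∑-⊕-invariant w (𝟙 ∘ g ∘ (true ∷_))) ⟩
    ∑[ c ∈ allVecs n ] 𝟙 (g ((false ∷ c) ⊕ (true ∷ w)))  ≡⟨ count-cong (λ c → inv (false ∷ c)) (allVecs n) ⟩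
    count (g ∘ (false ∷_)) (allVecs n)                   ∎
⊕-invariant⇒count-even {suc n} {w = false ∷ w} w≢0 g inv = begin
  parity (count g (allVecs (suc n)))
    ≡⟨ cong parity (∑-allVecs-suc n (𝟙 ∘ g)) ⟩
  parity (count (g ∘ (false ∷_)) (allVecs n) + count (g ∘ (true ∷_)) (allVecs n))
    ≡⟨ parity-+ (count (g ∘ (false ∷_)) (allVecs n)) _ ⟩
  parity (count (g ∘ (false ∷_)) (allVecs n)) xor parity (count (g ∘ (true ∷_)) (allVecs n))
    ≡⟨ cong₂ _xor_ (⊕-invariant⇒count-even w≢0' (g ∘ (false ∷_)) (inv ∘ (false ∷_)))
                   (⊕-invariant⇒count-even w≢0' (g ∘ (true ∷_)) (inv ∘ (true ∷_))) ⟩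
  false ∎
  where
  w≢0' : ¬ w ≡ zeroVec
  w≢0' = w≢0 ∘ cong (false ∷_)

data Nodup {n} : List (F2^ n) → Set where
  []  : Nodup []
  _∷_ : ∀ {x L} → x ∈ᵇ L ≡ false → Nodup L → Nodup (x ∷ L)

Nodup-map : ∀ {m} (h : F2^ m → F2^ n) → (∀ {a b} → h a ≡ h b → a ≡ b) → ∀ {L} → Nodup L → Nodup (map h L)
Nodup-map h inj []            = []
Nodup-map h inj {x ∷ L} (x∉ ∷ nodup) = ∉ᵇ-map⁺ h inj x L x∉ ∷ Nodup-map h inj nodup

Nodup-++ : ∀ {xs ys : List (F2^ n)} → Nodup xs → Nodup ys →
  (∀ v → v ∈ᵇ xs ≡ true → v ∈ᵇ ys ≡ false) → Nodup (xs ++ ys)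
Nodup-++ []                       nys disjoint = nys
Nodup-++ {xs = x ∷ xs} {ys} (x∉ ∷ nxs) nys disjoint =
  trans (∈ᵇ-++ x xs ys) (cong₂ _∨_ x∉ (disjoint x (∈ᵇ-here x xs)))
  ∷ Nodup-++ nxs nys (λ v → disjoint v ∘ ∈ᵇ-there v x xs)

allVecs-Nodup : ∀ n → Nodup (allVecs n)
allVecs-Nodup zero    = refl ∷ []
allVecs-Nodup (suc n) = Nodup-++ (Nodup-map (false ∷_) ∷-injectiveʳ (allVecs-Nodup n))
                                 (Nodup-map (true ∷_) ∷-injectiveʳ (allVecs-Nodup n)) disjoint
  where
  ∷-injectiveʳ : ∀ {b} {u v : F2^ n} → b ∷ u ≡ b ∷ v → u ≡ v
  ∷-injectiveʳ refl = refl
  disjoint : ∀ v → v ∈ᵇ map (false ∷_) (allVecs n) ≡ true → v ∈ᵇ map (true ∷_) (allVecs n) ≡ false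
  disjoint v v∈ with ∈ᵇ-map⁻ (false ∷_) v (allVecs n) v∈
  ... | u , _ , refl with (false ∷ u) ∈ᵇ map (true ∷_) (allVecs n) in u∈
  ...   | false = refl
  ...   | true with ∈ᵇ-map⁻ (true ∷_) (false ∷ u) (allVecs n) u∈
  ...     | _ , _ , ()

count-==-∉ : ∀ (p : F2^ n → Bool) {x} L → x ∈ᵇ L ≡ false → count (λ y → (y == x) ∧ p y) L ≡ 0
count-==-∉ p      []      _  = refl
count-==-∉ p {x} (z ∷ L) x∉ =
  cong₂ _+_ (cong (λ b → 𝟙 (b ∧ p z)) z≠x) (count-==-∉ p L (Bool.∨-conicalʳ (x == z) _ x∉))
  where
  z≠x : z == x ≡ false
  z≠x = trans (==-comm z x) (Bool.∨-conicalˡ (x == z) _ x∉)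

count-==-∈ : ∀ (p : F2^ n → Bool) {x L} → Nodup L → x ∈ᵇ L ≡ true → count (λ y → (y == x) ∧ p y) L ≡ 𝟙 (p x)
count-==-∈ p {x} {z ∷ L} (z∉ ∷ nodup) x∈ with z == x in z=x
... | true with refl ← ==⇒≡ z x z=x = trans (cong (𝟙 (p x) +_) (count-==-∉ p L z∉)) (ℕ.+-identityʳ _)
... | false = count-==-∈ p nodup (trans (sym (cong (_∨ (x ∈ᵇ L)) (trans (==-comm x z) z=x))) x∈)

count-Nodup : ∀ (p : F2^ n → Bool) {L} → Nodup L → count p L ≡ count (λ y → (y ∈ᵇ L) ∧ p y) (allVecs n)
count-Nodup {n} p {[]}    []           = sym (count-false (allVecs n))
count-Nodup {n} p {x ∷ L} (x∉ ∷ nodup) = begin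
  𝟙 (p x) + count p L
    ≡⟨ cong₂ _+_ (sym (count-==-∈ p (allVecs-Nodup n) (∈ᵇ-allVecs x))) (count-Nodup p nodup) ⟩
  count (λ y → (y == x) ∧ p y) (allVecs n) + count (λ y → (y ∈ᵇ L) ∧ p y) (allVecs n)
    ≡⟨ sym (∑-+ (λ y → 𝟙 ((y == x) ∧ p y)) _ (allVecs n)) ⟩
  ∑[ y ∈ allVecs n ] (𝟙 ((y == x) ∧ p y) + 𝟙 ((y ∈ᵇ L) ∧ p y))
    ≡⟨ ∑-cong merge (allVecs n) ⟩
  count (λ y → (y ∈ᵇ (x ∷ L)) ∧ p y) (allVecs n) ∎
  where
  merge : ∀ y → 𝟙 ((y == x) ∧ p y) + 𝟙 ((y ∈ᵇ L) ∧ p y) ≡ 𝟙 (((y == x) ∨ (y ∈ᵇ L)) ∧ p y)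
  merge y with y == x in y=x
  ... | false = refl
  ... | true with refl ← ==⇒≡ y x y=x rewrite x∉ = ℕ.+-identityʳ _

length-Nodup : ∀ {L : List (F2^ n)} → Nodup L → length L ≡ count (_∈ᵇ L) (allVecs n)
length-Nodup {n} {L} nodup = begin
  length L                                        ≡⟨ sym (count-true L) ⟩
  count (λ _ → true) L                            ≡⟨ count-Nodup (λ _ → true) nodup ⟩
  count (λ y → (y ∈ᵇ L) ∧ true) (allVecs n)       ≡⟨ count-cong (λ y → Bool.∧-identityʳ (y ∈ᵇ L)) (allVecs n) ⟩
  count (_∈ᵇ L) (allVecs n)                       ∎

_⊆_ : List (F2^ n) → List (F2^ n) → Set
U ⊆ V = ∀ v → v ∈ᵇ U ≡ true → v ∈ᵇ V ≡ true

⊆-∉ : ∀ {U V : List (F2^ n)} {x} → U ⊆ V → x ∈ᵇ V ≡ false → x ∈ᵇ U ≡ false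
⊆-∉ {U = U} {x = x} U⊆V x∉V with x ∈ᵇ U in x∈U
... | false = refl
... | true  = trans (sym (U⊆V x x∈U)) x∉V

⊆-antisym : ∀ {U V : List (F2^ n)} → U ⊆ V → V ⊆ U → ∀ y → y ∈ᵇ U ≡ y ∈ᵇ V
⊆-antisym {U = U} {V} U⊆V V⊆U y with y ∈ᵇ U in y∈U | y ∈ᵇ V in y∈V
... | true  | true  = refl
... | false | false = refl
... | true  | false = trans (sym (U⊆V y y∈U)) y∈V
... | false | true  = trans (sym y∈U) (V⊆U y y∈V)

length-⊆ : ∀ {L U : List (F2^ n)} → Nodup L → Nodup U → L ⊆ U →
  length U ≡ length L + count (λ y → (y ∈ᵇ U) ∧ not (y ∈ᵇ L)) (allVecs n)
length-⊆ {n} {L} {U} nodupL nodupU L⊆U = begin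
  length U                                                  ≡⟨ length-Nodup nodupU ⟩
  count (_∈ᵇ U) (allVecs n)                                 ≡⟨ count-split (_∈ᵇ L) (_∈ᵇ U) (allVecs n) ⟩
  count (λ y → (y ∈ᵇ U) ∧ (y ∈ᵇ L)) (allVecs n) + outside   ≡⟨ cong (_+ outside) (count-cong inside (allVecs n)) ⟩
  count (_∈ᵇ L) (allVecs n) + outside                       ≡⟨ cong (_+ outside) (sym (length-Nodup nodupL)) ⟩
  length L + outside                                        ∎
  where
  outside : ℕ
  outside = count (λ y → (y ∈ᵇ U) ∧ not (y ∈ᵇ L)) (allVecs n)
  inside : ∀ y → (y ∈ᵇ U) ∧ (y ∈ᵇ L) ≡ y ∈ᵇ L
  inside y with y ∈ᵇ L in y∈L
  ... | true  = trans (Bool.∧-identityʳ _) (L⊆U y y∈L)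
  ... | false = Bool.∧-zeroʳ _

⊆∧same-length⇒⊇ : ∀ {L U : List (F2^ n)} → Nodup L → Nodup U → L ⊆ U → length U ≡ length L → U ⊆ L
⊆∧same-length⇒⊇ {n} {L} {U} nodupL nodupU L⊆U |U|≡|L| y y∈U =
  Bool.not-injective (trans (sym (cong (_∧ not (y ∈ᵇ L)) y∈U)) (All-allVecs outside≡∅ y))
  where
  outside≡0 : count (λ y → (y ∈ᵇ U) ∧ not (y ∈ᵇ L)) (allVecs n) ≡ 0
  outside≡0 = ℕ.+-cancelˡ-≡ (length L) _ 0
    (trans (sym (length-⊆ nodupL nodupU L⊆U)) (trans |U|≡|L| (sym (ℕ.+-identityʳ _))))
  outside≡∅ : All (λ y → (y ∈ᵇ U) ∧ not (y ∈ᵇ L) ≡ false) (allVecs n)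
  outside≡∅ = count≡0⇒All-false (λ y → (y ∈ᵇ U) ∧ not (y ∈ᵇ L)) (allVecs n) outside≡0

hasIndicator : List (F2^ n) → (F2^ n → Bool) → List (F2^ n) → Bool
hasIndicator xs χ U = all (λ y → (y ∈ᵇ U) ≡ᵇ χ y) xs

hasIndicator⇒≈ : ∀ {χ : F2^ n → Bool} {U} → hasIndicator (allVecs n) χ U ≡ true → ∀ y → y ∈ᵇ U ≡ χ y
hasIndicator⇒≈ {χ = χ} {U} indicator y = ≡ᵇ⇒≡ _ _ (all-allVecs {p = λ y → (y ∈ᵇ U) ≡ᵇ χ y} indicator y)

≈⇒hasIndicator : ∀ {χ : F2^ n → Bool} {U} → (∀ y → y ∈ᵇ U ≡ χ y) → hasIndicator (allVecs n) χ U ≡ true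
≈⇒hasIndicator {n} {χ} {U} U≈χ = ∈ᵇ⇒all (allVecs n) (λ y _ → dec-true ((y ∈ᵇ U) Bool.≟ χ y) (U≈χ y))

⨁-≈ : ∀ {U V : List (F2^ n)} → Nodup U → Nodup V → (∀ y → y ∈ᵇ U ≡ y ∈ᵇ V) → ∀ p → ⨁ U p ≡ ⨁ V p
⨁-≈ {n} {U} {V} nodupU nodupV U≈V p = begin
  ⨁ U p                                                 ≡⟨ ⨁≡parity∘count p U ⟩
  parity (count p U)                                    ≡⟨ cong parity (count-Nodup p nodupU) ⟩
  parity (count (λ y → (y ∈ᵇ U) ∧ p y) (allVecs n))     ≡⟨ cong parity (count-cong (λ y → cong (_∧ p y) (U≈V y)) (allVecs n)) ⟩
  parity (count (λ y → (y ∈ᵇ V) ∧ p y) (allVecs n))     ≡⟨ cong parity (sym (count-Nodup p nodupV)) ⟩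
  parity (count p V)                                    ≡⟨ sym (⨁≡parity∘count p V) ⟩
  ⨁ V p                                                 ∎

sublists-Nodup-⊆ : ∀ {xs : List (F2^ n)} → Nodup xs → All (λ U → Nodup U × U ⊆ xs) (sublists xs)
sublists-Nodup-⊆ {xs = []}     []           = ([] , λ _ ()) ∷ []
sublists-Nodup-⊆ {xs = x ∷ xs} (x∉ ∷ nodup) =
  All.++⁺ (All.map without-x IH) (All.map⁺ (All.map with-x IH))
  where
  IH : All (λ U → Nodup U × U ⊆ xs) (sublists xs)
  IH = sublists-Nodup-⊆ nodup
  without-x : ∀ {U} → Nodup U × U ⊆ xs → Nodup U × U ⊆ (x ∷ xs)
  without-x (nodupU , U⊆xs) = nodupU , λ v → ∈ᵇ-there v x xs ∘ U⊆xs v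
  with-x : ∀ {U} → Nodup U × U ⊆ xs → Nodup (x ∷ U) × (x ∷ U) ⊆ (x ∷ xs)
  with-x {U} (nodupU , U⊆xs) = ⊆-∉ {U = U} {xs} {x} U⊆xs x∉ ∷ nodupU , x∷U⊆x∷xs
    where
    x∷U⊆x∷xs : (x ∷ U) ⊆ (x ∷ xs)
    x∷U⊆x∷xs v v∈ with v == x
    ... | true  = refl
    ... | false = U⊆xs v v∈

sublists-indicator-unique : ∀ {xs : List (F2^ n)} → Nodup xs → ∀ χ → count (hasIndicator xs χ) (sublists xs) ≡ 1
sublists-indicator-unique {xs = []}     []           χ = refl
sublists-indicator-unique {xs = x ∷ xs} (x∉ ∷ nodup) χ = begin
  count (hasIndicator (x ∷ xs) χ) (sublists xs ++ map (x ∷_) (sublists xs))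
    ≡⟨ ∑-++ _ (sublists xs) _ ⟩
  count (hasIndicator (x ∷ xs) χ) (sublists xs) + count (hasIndicator (x ∷ xs) χ) (map (x ∷_) (sublists xs))
    ≡⟨ cong₂ _+_ (∑-cong-All good (cong 𝟙 ∘ without-x))
                 (trans (∑-map _ (x ∷_) (sublists xs)) (∑-cong-All good (cong 𝟙 ∘ with-x))) ⟩
  count (λ U → (false ≡ᵇ χ x) ∧ hasIndicator xs χ U) (sublists xs)
    + count (λ U → (true ≡ᵇ χ x) ∧ hasIndicator xs χ U) (sublists xs)
    ≡⟨ cong₂ _+_ (count-∧ˡ (false ≡ᵇ χ x) _ (sublists xs)) (count-∧ˡ (true ≡ᵇ χ x) _ (sublists xs)) ⟩
  𝟙 (false ≡ᵇ χ x) * count (hasIndicator xs χ) (sublists xs)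
    + 𝟙 (true ≡ᵇ χ x) * count (hasIndicator xs χ) (sublists xs)
    ≡⟨ cong (λ c → 𝟙 (false ≡ᵇ χ x) * c + 𝟙 (true ≡ᵇ χ x) * c) (sublists-indicator-unique nodup χ) ⟩
  𝟙 (false ≡ᵇ χ x) * 1 + 𝟙 (true ≡ᵇ χ x) * 1
    ≡⟨ exactly-one (χ x) ⟩
  1 ∎
  where
  good : All (λ U → Nodup U × U ⊆ xs) (sublists xs)
  good = sublists-Nodup-⊆ nodup
  without-x : ∀ {U} → Nodup U × U ⊆ xs → hasIndicator (x ∷ xs) χ U ≡ (false ≡ᵇ χ x) ∧ hasIndicator xs χ U
  without-x {U} (_ , U⊆xs) = cong (λ b → (b ≡ᵇ χ x) ∧ hasIndicator xs χ U) (⊆-∉ {U = U} {xs} {x} U⊆xs x∉)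
  with-x : ∀ {U} → Nodup U × U ⊆ xs → hasIndicator (x ∷ xs) χ (x ∷ U) ≡ (true ≡ᵇ χ x) ∧ hasIndicator xs χ U
  with-x {U} _ = cong₂ (λ b c → (b ≡ᵇ χ x) ∧ c) (∈ᵇ-here x U) (all-cong-∈ᵇ xs same)
    where
    same : ∀ y → y ∈ᵇ xs ≡ true → ((y ∈ᵇ (x ∷ U)) ≡ᵇ χ y) ≡ ((y ∈ᵇ U) ≡ᵇ χ y)
    same y y∈xs with y == x in y=x
    ... | false = refl
    ... | true with refl ← ==⇒≡ y x y=x = ⊥-elim (Bool.not-¬ x∉ y∈xs)
  exactly-one : ∀ b → 𝟙 (false ≡ᵇ b) * 1 + 𝟙 (true ≡ᵇ b) * 1 ≡ 1
  exactly-one false = refl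
  exactly-one true  = refl

-- Linear maps F₂ʲ → F₂ⁿ

-- n rows of length j; ⟦ R ⟧ : F₂ʲ → F₂ⁿ, whose image is spanned by the j columns.
Matrix : ℕ → ℕ → Set
Matrix j n = Vec (F2^ j) n

_∙_ : F2^ j → F2^ j → Bool
[]      ∙ []      = false
(a ∷ ρ) ∙ (b ∷ c) = (a ∧ b) xor (ρ ∙ c)

⟦_⟧ : Matrix j n → F2^ j → F2^ n
⟦ R ⟧ c = Vec.map (_∙ c) R

matrices : (j n : ℕ) → List (Matrix j n)
matrices j = vectorsOver (allVecs j)

length-matrices : ∀ j n → length (matrices j n) ≡ 2 ^ (j * n)
length-matrices j n = begin
  length (matrices j n)     ≡⟨ length-vectorsOver (allVecs j) n ⟩
  length (allVecs j) ^ n    ≡⟨ cong (_^ n) (length-allVecs j) ⟩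
  (2 ^ j) ^ n               ≡⟨ ℕ.^-*-assoc 2 j n ⟩
  2 ^ (j * n)               ∎

span : Matrix j n → List (F2^ n)
span {j} R = map ⟦ R ⟧ (allVecs j)

∙-⊕ʳ : (ρ c c' : F2^ j) → ρ ∙ (c ⊕ c') ≡ (ρ ∙ c) xor (ρ ∙ c')
∙-⊕ʳ []      []      []        = refl
∙-⊕ʳ (a ∷ ρ) (b ∷ c) (b' ∷ c') = begin
  (a ∧ (b xor b')) xor (ρ ∙ (c ⊕ c'))               ≡⟨ cong₂ _xor_ (Bool.∧-distribˡ-xor a b b') (∙-⊕ʳ ρ c c') ⟩
  ((a ∧ b) xor (a ∧ b')) xor ((ρ ∙ c) xor (ρ ∙ c')) ≡⟨ Xor.interchange (a ∧ b) (a ∧ b') (ρ ∙ c) (ρ ∙ c') ⟩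
  ((a ∧ b) xor (ρ ∙ c)) xor ((a ∧ b') xor (ρ ∙ c')) ∎

∙-zeroʳ : (ρ : F2^ j) → ρ ∙ zeroVec ≡ false
∙-zeroʳ []      = refl
∙-zeroʳ (a ∷ ρ) = cong₂ _xor_ (Bool.∧-zeroʳ a) (∙-zeroʳ ρ)

⟦⟧-⊕ : (R : Matrix j n) (c c' : F2^ j) → ⟦ R ⟧ (c ⊕ c') ≡ ⟦ R ⟧ c ⊕ ⟦ R ⟧ c'
⟦⟧-⊕ []      c c' = refl
⟦⟧-⊕ (ρ ∷ R) c c' = cong₂ _∷_ (∙-⊕ʳ ρ c c') (⟦⟧-⊕ R c c')

⟦⟧-zero : (R : Matrix j n) → ⟦ R ⟧ zeroVec ≡ zeroVec
⟦⟧-zero []      = refl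
⟦⟧-zero (ρ ∷ R) = cong₂ _∷_ (∙-zeroʳ ρ) (⟦⟧-zero R)

length-span : (R : Matrix j n) → length (span R) ≡ 2 ^ j
length-span {j} R = trans (List.length-map ⟦ R ⟧ (allVecs j)) (length-allVecs j)

∈ᵇ-span : (R : Matrix j n) (c : F2^ j) → ⟦ R ⟧ c ∈ᵇ span R ≡ true
∈ᵇ-span {j} R c = ∈ᵇ-map⁺ ⟦ R ⟧ c (allVecs j) (∈ᵇ-allVecs c)

isInjective : Matrix j n → Bool
isInjective {j} R = all (λ c → (c == zeroVec) ∨ not (⟦ R ⟧ c == zeroVec)) (allVecs j)

isInjective⇒injective : (R : Matrix j n) → isInjective R ≡ true → ∀ {c c'} → ⟦ R ⟧ c ≡ ⟦ R ⟧ c' → c ≡ c'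
isInjective⇒injective {n = n} R inj {c} {c'} Rc≡Rc' = ⊕≡zero⇒≡ (==⇒≡ (c ⊕ c') zeroVec c⊕c'==0)
  where
  R[c⊕c']≡0 : ⟦ R ⟧ (c ⊕ c') ≡ zeroVec
  R[c⊕c']≡0 = trans (⟦⟧-⊕ R c c') (trans (cong (_⊕ ⟦ R ⟧ c') Rc≡Rc') (⊕-self (⟦ R ⟧ c')))
  c⊕c'==0 : (c ⊕ c') == zeroVec ≡ true
  c⊕c'==0 = trans (sym (Bool.∨-identityʳ _))
              (subst (λ b → ((c ⊕ c') == zeroVec) ∨ not b ≡ true)
                     (trans (cong (_== zeroVec) R[c⊕c']≡0) (==-refl {n} zeroVec)) (all-allVecs inj (c ⊕ c')))

¬isInjective⇒kernel : (R : Matrix j n) → isInjective R ≡ false → Σ (F2^ j) λ w → ¬ w ≡ zeroVec × ⟦ R ⟧ w ≡ zeroVec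
¬isInjective⇒kernel {j} R ¬inj with all≡false⇒∃ _ (allVecs j) ¬inj
... | w , w-witness = w ,
  (λ w≡0 → Bool.not-¬ (==-refl {j} zeroVec) (trans (cong (_== zeroVec) (sym w≡0)) (Bool.∨-conicalˡ _ _ w-witness))) ,
  ==⇒≡ (⟦ R ⟧ w) zeroVec (Bool.not-injective (Bool.∨-conicalʳ (w == zeroVec) _ w-witness))

span-Nodup : (R : Matrix j n) → isInjective R ≡ true → Nodup (span R)
span-Nodup {j} R inj = Nodup-map ⟦ R ⟧ (isInjective⇒injective R inj) (allVecs-Nodup j)

⨁-span-nonInjective : (R : Matrix j n) → isInjective R ≡ false → ∀ (p : F2^ n → Bool) → ⨁ (span R) p ≡ false
⨁-span-nonInjective {j} R ¬inj p with ¬isInjective⇒kernel R ¬inj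
... | w , w≢0 , Rw≡0 = begin
  ⨁ (span R) p                              ≡⟨ ⨁-map p ⟦ R ⟧ (allVecs j) ⟩
  ⨁ (allVecs j) (p ∘ ⟦ R ⟧)                 ≡⟨ ⨁≡parity∘count (p ∘ ⟦ R ⟧) (allVecs j) ⟩
  parity (count (p ∘ ⟦ R ⟧) (allVecs j))    ≡⟨ ⊕-invariant⇒count-even w≢0 (p ∘ ⟦ R ⟧) invariant ⟩
  false                                     ∎
  where
  invariant : ∀ c → p (⟦ R ⟧ (c ⊕ w)) ≡ p (⟦ R ⟧ c)
  invariant c = cong p (trans (⟦⟧-⊕ R c w) (trans (cong (⟦ R ⟧ c ⊕_) Rw≡0) (⊕-identityʳ (⟦ R ⟧ c))))

addColumn : F2^ n → Matrix j n → Matrix (suc j) n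
addColumn = zipWith _∷_

⟦addColumn⟧-false : (v : F2^ n) (R : Matrix j n) (c : F2^ j) → ⟦ addColumn v R ⟧ (false ∷ c) ≡ ⟦ R ⟧ c
⟦addColumn⟧-false []      []      c = refl
⟦addColumn⟧-false (a ∷ v) (ρ ∷ R) c = cong₂ _∷_ (cong (_xor (ρ ∙ c)) (Bool.∧-zeroʳ a)) (⟦addColumn⟧-false v R c)

⟦addColumn⟧-true : (v : F2^ n) (R : Matrix j n) (c : F2^ j) → ⟦ addColumn v R ⟧ (true ∷ c) ≡ v ⊕ ⟦ R ⟧ c
⟦addColumn⟧-true []      []      c = refl
⟦addColumn⟧-true (a ∷ v) (ρ ∷ R) c = cong₂ _∷_ (cong (_xor (ρ ∙ c)) (Bool.∧-identityʳ a)) (⟦addColumn⟧-true v R c)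

∑-matrices-addColumn : ∀ (F : Matrix (suc j) n → ℕ) →
  ∑ (matrices (suc j) n) F ≡ ∑[ v ∈ allVecs n ] ∑[ R ∈ matrices j n ] F (addColumn v R)
∑-matrices-addColumn {n = zero}      F = sym (ℕ.+-identityʳ (F [] + 0))
∑-matrices-addColumn {j} {n = suc n} F = begin
  ∑ (matrices (suc j) (suc n)) F
    ≡⟨ ∑-vectorsOver-suc F (allVecs (suc j)) ⟩
  ∑[ ρ ∈ allVecs (suc j) ] ∑[ R ∈ matrices (suc j) n ] F (ρ ∷ R)
    ≡⟨ ∑-cong (λ ρ → ∑-matrices-addColumn (F ∘ (ρ ∷_))) (allVecs (suc j)) ⟩
  ∑[ ρ ∈ allVecs (suc j) ] ∑[ v ∈ allVecs n ] ∑[ R ∈ matrices j n ] F (ρ ∷ addColumn v R)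
    ≡⟨ ∑-allVecs-suc j (λ ρ → ∑[ v ∈ allVecs n ] ∑[ R ∈ matrices j n ] F (ρ ∷ addColumn v R)) ⟩
  half false + half true
    ≡⟨ cong₂ _+_ (∑-swap _ (allVecs j) (allVecs n)) (∑-swap _ (allVecs j) (allVecs n)) ⟩
  ∑[ v ∈ allVecs n ] ∑[ ρ ∈ allVecs j ] H false v ρ + ∑[ v ∈ allVecs n ] ∑[ ρ ∈ allVecs j ] H true v ρ
    ≡⟨ cong₂ _+_ (∑-cong (λ v → sym (∑-vectorsOver-suc _ (allVecs j))) (allVecs n))
                 (∑-cong (λ v → sym (∑-vectorsOver-suc _ (allVecs j))) (allVecs n)) ⟩
  ∑[ v ∈ allVecs n ] ∑[ R ∈ matrices j (suc n) ] F (addColumn (false ∷ v) R)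
    + ∑[ v ∈ allVecs n ] ∑[ R ∈ matrices j (suc n) ] F (addColumn (true ∷ v) R)
    ≡⟨ sym (∑-allVecs-suc n (λ v → ∑[ R ∈ matrices j (suc n) ] F (addColumn v R))) ⟩
  ∑[ v ∈ allVecs (suc n) ] ∑[ R ∈ matrices j (suc n) ] F (addColumn v R) ∎
  where
  H : Bool → F2^ n → F2^ j → ℕ
  H b v ρ = ∑[ R ∈ matrices j n ] F ((b ∷ ρ) ∷ addColumn v R)
  half : Bool → ℕ
  half b = ∑[ ρ ∈ allVecs j ] ∑[ v ∈ allVecs n ] H b v ρ

isInjective-addColumn : (v : F2^ n) (R : Matrix j n) → isInjective (addColumn v R) ≡ isInjective R ∧ not (v ∈ᵇ span R)
isInjective-addColumn {j = j} v R = begin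
  isInjective (addColumn v R)
    ≡⟨ all-allVecs-suc (λ c → (c == zeroVec) ∨ not (⟦ addColumn v R ⟧ c == zeroVec)) ⟩
  all (λ c → ((false ∷ c) == zeroVec) ∨ not (⟦ addColumn v R ⟧ (false ∷ c) == zeroVec)) (allVecs j)
    ∧ all (λ c → ((true ∷ c) == zeroVec) ∨ not (⟦ addColumn v R ⟧ (true ∷ c) == zeroVec)) (allVecs j)
    ≡⟨ cong₂ _∧_ (all-cong old-columns (allVecs j)) (all-cong new-column (allVecs j)) ⟩
  isInjective R ∧ all (λ c → not (v == ⟦ R ⟧ c)) (allVecs j)
    ≡⟨ cong (isInjective R ∧_) (all-≢⇒∉ᵇ v ⟦ R ⟧ (allVecs j)) ⟩
  isInjective R ∧ not (v ∈ᵇ span R) ∎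
  where
  old-columns : ∀ c → ((false ∷ c) == zeroVec) ∨ not (⟦ addColumn v R ⟧ (false ∷ c) == zeroVec)
                    ≡ (c == zeroVec) ∨ not (⟦ R ⟧ c == zeroVec)
  old-columns c = cong₂ (λ a b → a ∨ not (b == zeroVec)) (==-∷ false c zeroVec) (⟦addColumn⟧-false v R c)
  new-column : ∀ c → ((true ∷ c) == zeroVec) ∨ not (⟦ addColumn v R ⟧ (true ∷ c) == zeroVec) ≡ not (v == ⟦ R ⟧ c)
  new-column c = cong₂ (λ a b → a ∨ not b) (≢⇒==-false {u = true ∷ c} {zeroVec} (λ ()))
                       (trans (cong (_== zeroVec) (⟦addColumn⟧-true v R c)) (⊕==zero v (⟦ R ⟧ c)))

-- Subspaces and their ordered bases

record IsSubspaceOfDim (k : ℕ) (U : List (F2^ n)) : Set where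
  field
    nodup    : Nodup U
    zero∈    : zeroVec ∈ᵇ U ≡ true
    ⊕-closed : ∀ u v → u ∈ᵇ U ≡ true → v ∈ᵇ U ≡ true → (u ⊕ v) ∈ᵇ U ≡ true
    length≡  : length U ≡ 2 ^ k

isSubspaceOfDim-sound : ∀ {U : List (F2^ n)} → Nodup U → isSubspaceOfDim k U ≡ true → IsSubspaceOfDim k U
isSubspaceOfDim-sound {n} {k} {U} nodup isSub = record
  { nodup    = nodup
  ; zero∈    = Bool.∧-conicalˡ _ _ subspace
  ; ⊕-closed = λ u v u∈U v∈U → all⇒∈ᵇ⇒ {p = λ v → (u ⊕ v) ∈ᵇ U} {v} U
                                  (all⇒∈ᵇ⇒ {p = λ u → all (λ v → (u ⊕ v) ∈ᵇ U) U} {u} U (Bool.∧-conicalʳ _ _ subspace) u∈U) v∈U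
  ; length≡  = length≡
  }
  where
  subspace : isSubspace U ≡ true
  subspace = Bool.∧-conicalˡ _ _ isSub
  length≡ : length U ≡ 2 ^ k
  length≡ = does⇒ (length U ℕ.≟ 2 ^ k) (Bool.∧-conicalʳ (isSubspace U) _ isSub)

isSubspaceOfDim-complete : ∀ {U : List (F2^ n)} → IsSubspaceOfDim k U → isSubspaceOfDim k U ≡ true
isSubspaceOfDim-complete {n} {k} {U} U-subspace =
  cong₂ _∧_ (cong₂ _∧_ zero∈ (∈ᵇ⇒all {p = λ u → all (λ v → (u ⊕ v) ∈ᵇ U) U} U
                               (λ u u∈U → ∈ᵇ⇒all {p = λ v → (u ⊕ v) ∈ᵇ U} U (λ v v∈U → ⊕-closed u v u∈U v∈U))))
            (dec-true (length U ℕ.≟ 2 ^ k) length≡)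
  where open IsSubspaceOfDim U-subspace

IsSubspaceOfDim-resp : ∀ {U V : List (F2^ n)} → Nodup U → (∀ y → y ∈ᵇ U ≡ y ∈ᵇ V) →
  IsSubspaceOfDim k V → IsSubspaceOfDim k U
IsSubspaceOfDim-resp {n} {U = U} {V} nodupU U≈V V-subspace = record
  { nodup    = nodupU
  ; zero∈    = trans (U≈V zeroVec) zero∈
  ; ⊕-closed = λ u v u∈U v∈U → trans (U≈V (u ⊕ v)) (⊕-closed u v (trans (sym (U≈V u)) u∈U) (trans (sym (U≈V v)) v∈U))
  ; length≡  = trans (length-Nodup nodupU) (trans (count-cong U≈V (allVecs n)) (trans (sym (length-Nodup nodup)) length≡))
  }
  where open IsSubspaceOfDim V-subspace

allVecs-IsSubspaceOfDim : ∀ n → IsSubspaceOfDim n (allVecs n)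
allVecs-IsSubspaceOfDim n = record
  { nodup    = allVecs-Nodup n
  ; zero∈    = ∈ᵇ-allVecs {n} zeroVec
  ; ⊕-closed = λ u v _ _ → ∈ᵇ-allVecs (u ⊕ v)
  ; length≡  = length-allVecs n
  }

span-IsSubspaceOfDim : (R : Matrix k n) → isInjective R ≡ true → IsSubspaceOfDim k (span R)
span-IsSubspaceOfDim {k = k} R inj = record
  { nodup    = span-Nodup R inj
  ; zero∈    = subst (λ z → z ∈ᵇ span R ≡ true) (⟦⟧-zero R) (∈ᵇ-span R zeroVec)
  ; ⊕-closed = closed
  ; length≡  = length-span R
  }
  where
  closed : ∀ u v → u ∈ᵇ span R ≡ true → v ∈ᵇ span R ≡ true → (u ⊕ v) ∈ᵇ span R ≡ true
  closed u v u∈ v∈ with ∈ᵇ-map⁻ ⟦ R ⟧ u (allVecs k) u∈ | ∈ᵇ-map⁻ ⟦ R ⟧ v (allVecs k) v∈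
  ... | c , _ , refl | c' , _ , refl = subst (λ z → z ∈ᵇ span R ≡ true) (⟦⟧-⊕ R c c') (∈ᵇ-span R (c ⊕ c'))

spanWithin : Matrix j n → List (F2^ n) → Bool
spanWithin {j} R U = all (λ c → ⟦ R ⟧ c ∈ᵇ U) (allVecs j)

spanWithin⇒⊆ : (R : Matrix j n) (U : List (F2^ n)) → spanWithin R U ≡ true → span R ⊆ U
spanWithin⇒⊆ {j} R U within v v∈span with ∈ᵇ-map⁻ ⟦ R ⟧ v (allVecs j) v∈span
... | c , _ , refl = all-allVecs within c

independentIn : List (F2^ n) → Matrix j n → Bool
independentIn U R = isInjective R ∧ spanWithin R U

module _ {U : List (F2^ n)} (U-subspace : IsSubspaceOfDim k U) where
  open IsSubspaceOfDim U-subspace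

  spanWithin-addColumn : (v : F2^ n) (R : Matrix j n) → spanWithin R U ≡ true →
    all (λ c → (v ⊕ ⟦ R ⟧ c) ∈ᵇ U) (allVecs j) ≡ v ∈ᵇ U
  spanWithin-addColumn {j} v R within with v ∈ᵇ U in v∈U
  ... | true  = ∈ᵇ⇒all (allVecs j) (λ c _ → ⊕-closed v (⟦ R ⟧ c) v∈U (all-allVecs within c))
  ... | false with all (λ c → (v ⊕ ⟦ R ⟧ c) ∈ᵇ U) (allVecs j) in shifted-within
  ...   | false = refl
  ...   | true  = trans (sym (subst (λ w → w ∈ᵇ U ≡ true) v⊕0≡v shift-by-0)) v∈U
    where
    shift-by-0 : (v ⊕ ⟦ R ⟧ zeroVec) ∈ᵇ U ≡ true
    shift-by-0 = all-allVecs {p = λ c → (v ⊕ ⟦ R ⟧ c) ∈ᵇ U} shifted-within zeroVec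
    v⊕0≡v : v ⊕ ⟦ R ⟧ zeroVec ≡ v
    v⊕0≡v = trans (cong (v ⊕_) (⟦⟧-zero R)) (⊕-identityʳ v)

  independentIn-addColumn : (v : F2^ n) (R : Matrix j n) →
    independentIn U (addColumn v R) ≡ independentIn U R ∧ ((v ∈ᵇ U) ∧ not (v ∈ᵇ span R))
  independentIn-addColumn {j} v R = begin
    isInjective (addColumn v R) ∧ spanWithin (addColumn v R) U
      ≡⟨ cong₂ _∧_ (isInjective-addColumn v R) (all-allVecs-suc (λ c → ⟦ addColumn v R ⟧ c ∈ᵇ U)) ⟩
    (isInjective R ∧ not (v ∈ᵇ span R)) ∧ (all (λ c → ⟦ addColumn v R ⟧ (false ∷ c) ∈ᵇ U) (allVecs j)
                                           ∧ all (λ c → ⟦ addColumn v R ⟧ (true ∷ c) ∈ᵇ U) (allVecs j))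
      ≡⟨ cong (λ b → (isInjective R ∧ not (v ∈ᵇ span R)) ∧ b)
              (cong₂ _∧_ (all-cong (λ c → cong (_∈ᵇ U) (⟦addColumn⟧-false v R c)) (allVecs j))
                         (all-cong (λ c → cong (_∈ᵇ U) (⟦addColumn⟧-true v R c)) (allVecs j))) ⟩
    (isInjective R ∧ not (v ∈ᵇ span R)) ∧ (spanWithin R U ∧ all (λ c → (v ⊕ ⟦ R ⟧ c) ∈ᵇ U) (allVecs j))
      ≡⟨ rearrange (isInjective R) (not (v ∈ᵇ span R)) (spanWithin R U) (spanWithin-addColumn v R) ⟩
    (isInjective R ∧ spanWithin R U) ∧ ((v ∈ᵇ U) ∧ not (v ∈ᵇ span R)) ∎
    where
    rearrange : ∀ a b c {d e} → (c ≡ true → d ≡ e) → (a ∧ b) ∧ (c ∧ d) ≡ (a ∧ c) ∧ (e ∧ b)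
    rearrange a     b     false _   = trans (Bool.∧-zeroʳ (a ∧ b)) (sym (cong (_∧ _) (Bool.∧-zeroʳ a)))
    rearrange false b     true  _   = refl
    rearrange true  b     true  d≡e rewrite d≡e refl = Bool.∧-comm b _

  count-outside-span : (R : Matrix j n) → isInjective R ≡ true → spanWithin R U ≡ true →
    count (λ v → (v ∈ᵇ U) ∧ not (v ∈ᵇ span R)) (allVecs n) ≡ 2 ^ k ∸ 2 ^ j
  count-outside-span {j} R inj within = begin
    outside                        ≡⟨ sym (ℕ.m+n∸m≡n (2 ^ j) outside) ⟩
    2 ^ j + outside ∸ 2 ^ j        ≡⟨ cong (λ m → m + outside ∸ 2 ^ j) (sym (length-span R)) ⟩
    length (span R) + outside ∸ 2 ^ j ≡⟨ cong (_∸ 2 ^ j) (sym (length-⊆ (span-Nodup R inj) nodup (spanWithin⇒⊆ R U within))) ⟩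
    length U ∸ 2 ^ j               ≡⟨ cong (_∸ 2 ^ j) length≡ ⟩
    2 ^ k ∸ 2 ^ j                  ∎
    where
    outside : ℕ
    outside = count (λ v → (v ∈ᵇ U) ∧ not (v ∈ᵇ span R)) (allVecs n)

  -- Columns are chosen one at a time, the (j+1)-st in U outside the 2^j-element span of the first j.
  count-independentIn : ∀ j → count (independentIn U) (matrices j n) ≡ Gprod k j
  count-independentIn zero = begin
    count (independentIn U) (matrices 0 n)  ≡⟨ count-cong (λ R → cong (λ b → true ∧ b ∧ true) (zero-column R)) (matrices 0 n) ⟩
    count (λ _ → true) (matrices 0 n)       ≡⟨ count-true (matrices 0 n) ⟩
    length (matrices 0 n)                   ≡⟨ length-matrices 0 n ⟩
    1                                       ∎
    where
    zero-column : (R : Matrix 0 n) → ⟦ R ⟧ [] ∈ᵇ U ≡ true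
    zero-column R = trans (cong (_∈ᵇ U) (⟦⟧-zero R)) zero∈
  count-independentIn (suc j) = begin
    count (independentIn U) (matrices (suc j) n)
      ≡⟨ ∑-matrices-addColumn (𝟙 ∘ independentIn U) ⟩
    ∑[ v ∈ allVecs n ] ∑[ R ∈ matrices j n ] 𝟙 (independentIn U (addColumn v R))
      ≡⟨ ∑-cong (λ v → count-cong (independentIn-addColumn v) (matrices j n)) (allVecs n) ⟩
    ∑[ v ∈ allVecs n ] ∑[ R ∈ matrices j n ] 𝟙 (independentIn U R ∧ new v R)
      ≡⟨ ∑-swap _ (allVecs n) (matrices j n) ⟩
    ∑[ R ∈ matrices j n ] count (λ v → independentIn U R ∧ new v R) (allVecs n)
      ≡⟨ ∑-cong (λ R → count-∧ˡ (independentIn U R) (λ v → new v R) (allVecs n)) (matrices j n) ⟩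
    ∑[ R ∈ matrices j n ] (𝟙 (independentIn U R) * count (λ v → new v R) (allVecs n))
      ≡⟨ ∑-cong choices (matrices j n) ⟩
    ∑[ R ∈ matrices j n ] (𝟙 (independentIn U R) * (2 ^ k ∸ 2 ^ j))
      ≡⟨ ∑-*ʳ (2 ^ k ∸ 2 ^ j) (𝟙 ∘ independentIn U) (matrices j n) ⟩
    count (independentIn U) (matrices j n) * (2 ^ k ∸ 2 ^ j)
      ≡⟨ cong (_* (2 ^ k ∸ 2 ^ j)) (count-independentIn j) ⟩
    Gprod k j * (2 ^ k ∸ 2 ^ j) ∎
    where
    new : F2^ n → Matrix j n → Bool
    new v R = (v ∈ᵇ U) ∧ not (v ∈ᵇ span R)
    choices : ∀ R → 𝟙 (independentIn U R) * count (λ v → new v R) (allVecs n) ≡ 𝟙 (independentIn U R) * (2 ^ k ∸ 2 ^ j)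
    choices R with isInjective R in inj | spanWithin R U in within
    ... | true  | true  = cong (1 *_) (count-outside-span R inj within)
    ... | true  | false = refl
    ... | false | _     = refl

-- Counting N_k(f) through ordered bases

spanSum : ANF n → Matrix j n → Bool
spanSum f R = sumOver f (span R)

module _ (R : Matrix k n) (inj : isInjective R ≡ true) where

  spannedBy : List (F2^ n) → Bool
  spannedBy = hasIndicator (allVecs n) (_∈ᵇ span R)

  subspace∧spanWithin≡spannedBy : ∀ {U} → Nodup U → isSubspaceOfDim k U ∧ spanWithin R U ≡ spannedBy U
  subspace∧spanWithin≡spannedBy {U} nodup with spannedBy U in spanned
  ... | true = cong₂ _∧_ (isSubspaceOfDim-complete (IsSubspaceOfDim-resp nodup U≈span (span-IsSubspaceOfDim R inj)))
                         (∈ᵇ⇒all (allVecs k) (λ c _ → trans (U≈span (⟦ R ⟧ c)) (∈ᵇ-span R c)))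
    where
    U≈span : ∀ y → y ∈ᵇ U ≡ y ∈ᵇ span R
    U≈span = hasIndicator⇒≈ {U = U} spanned
  ... | false with isSubspaceOfDim k U in isSub | spanWithin R U in within
  ...   | false | _     = refl
  ...   | true  | false = refl
  ...   | true  | true  = trans (sym (≈⇒hasIndicator {U = U} U≈span)) spanned
    where
    open IsSubspaceOfDim (isSubspaceOfDim-sound {k = k} nodup isSub) using (length≡)
    span⊆U : span R ⊆ U
    span⊆U = spanWithin⇒⊆ R U within
    U≈span : ∀ y → y ∈ᵇ U ≡ y ∈ᵇ span R
    U≈span = ⊆-antisym {U = U} {span R}
               (⊆∧same-length⇒⊇ (span-Nodup R inj) nodup span⊆U (trans length≡ (sym (length-span R)))) span⊆U

  subspaceSum∧independentIn≡spanSum∧spannedBy : ∀ (f : ANF n) {U} → Nodup U →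
    (isSubspaceOfDim k U ∧ sumOver f U) ∧ independentIn U R ≡ spanSum f R ∧ spannedBy U
  subspaceSum∧independentIn≡spanSum∧spannedBy f {U} nodup = begin
    (isSubspaceOfDim k U ∧ sumOver f U) ∧ (isInjective R ∧ spanWithin R U)
      ≡⟨ cong (λ b → (isSubspaceOfDim k U ∧ sumOver f U) ∧ (b ∧ spanWithin R U)) inj ⟩
    (isSubspaceOfDim k U ∧ sumOver f U) ∧ spanWithin R U
      ≡⟨ ∧.xy∙z≈xz∙y (isSubspaceOfDim k U) (sumOver f U) (spanWithin R U) ⟩
    (isSubspaceOfDim k U ∧ spanWithin R U) ∧ sumOver f U
      ≡⟨ cong (_∧ sumOver f U) (subspace∧spanWithin≡spannedBy nodup) ⟩
    spannedBy U ∧ sumOver f U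
      ≡⟨ ∧-congˡ-true (λ spanned → ⨁-≈ nodup (span-Nodup R inj) (hasIndicator⇒≈ {U = U} spanned) (eval f)) ⟩
    spannedBy U ∧ spanSum f R
      ≡⟨ Bool.∧-comm (spannedBy U) (spanSum f R) ⟩
    spanSum f R ∧ spannedBy U ∎

count-subspaces-spanned-by : ∀ (f : ANF n) (R : Matrix k n) →
  count (λ U → (isSubspaceOfDim k U ∧ sumOver f U) ∧ independentIn U R) (subsetsF2 n) ≡ 𝟙 (spanSum f R)
count-subspaces-spanned-by {n} {k} f R with isInjective R in inj
... | false = begin
  count (λ U → (isSubspaceOfDim k U ∧ sumOver f U) ∧ false) (subsetsF2 n)
    ≡⟨ count-cong (λ U → Bool.∧-zeroʳ (isSubspaceOfDim k U ∧ sumOver f U)) (subsetsF2 n) ⟩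
  count (λ _ → false) (subsetsF2 n)
    ≡⟨ count-false (subsetsF2 n) ⟩
  0
    ≡⟨ cong 𝟙 (sym (⨁-span-nonInjective R inj (eval f))) ⟩
  𝟙 (spanSum f R) ∎
... | true = begin
  count (λ U → (isSubspaceOfDim k U ∧ sumOver f U) ∧ (true ∧ spanWithin R U)) (subsetsF2 n)
    ≡⟨ count-cong (λ U → cong (λ b → (isSubspaceOfDim k U ∧ sumOver f U) ∧ (b ∧ spanWithin R U)) (sym inj)) (subsetsF2 n) ⟩
  count (λ U → (isSubspaceOfDim k U ∧ sumOver f U) ∧ independentIn U R) (subsetsF2 n)
    ≡⟨ ∑-cong-All (sublists-Nodup-⊆ (allVecs-Nodup n))
         (λ (nodup , _) → cong 𝟙 (subspaceSum∧independentIn≡spanSum∧spannedBy R inj f nodup)) ⟩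
  count (λ U → spanSum f R ∧ spannedBy R inj U) (subsetsF2 n)
    ≡⟨ count-∧ˡ (spanSum f R) (spannedBy R inj) (subsetsF2 n) ⟩
  𝟙 (spanSum f R) * count (spannedBy R inj) (subsetsF2 n)
    ≡⟨ cong (𝟙 (spanSum f R) *_) (sublists-indicator-unique (allVecs-Nodup n) (_∈ᵇ span R)) ⟩
  𝟙 (spanSum f R) * 1
    ≡⟨ ℕ.*-identityʳ _ ⟩
  𝟙 (spanSum f R) ∎

length-N*G≡count-spanSum : ∀ k (f : ANF n) → length (N k f) * G k ≡ count (spanSum f) (matrices k n)
length-N*G≡count-spanSum {n} k f = begin
  length (N k f) * G k
    ≡⟨ cong (_* G k) (length-filter selected (subsetsF2 n)) ⟩
  count selected (subsetsF2 n) * G k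
    ≡⟨ sym (∑-*ʳ (G k) (𝟙 ∘ selected) (subsetsF2 n)) ⟩
  ∑[ U ∈ subsetsF2 n ] (𝟙 (selected U) * G k)
    ≡⟨ ∑-cong-All (sublists-Nodup-⊆ (allVecs-Nodup n)) (λ (nodup , _) → count-bases nodup) ⟩
  ∑[ U ∈ subsetsF2 n ] (𝟙 (selected U) * count (independentIn U) (matrices k n))
    ≡⟨ ∑-cong (λ U → sym (count-∧ˡ (selected U) (independentIn U) (matrices k n))) (subsetsF2 n) ⟩
  ∑[ U ∈ subsetsF2 n ] count (λ R → selected U ∧ independentIn U R) (matrices k n)
    ≡⟨ ∑-swap _ (subsetsF2 n) (matrices k n) ⟩
  ∑[ R ∈ matrices k n ] count (λ U → selected U ∧ independentIn U R) (subsetsF2 n)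
    ≡⟨ ∑-cong (count-subspaces-spanned-by f) (matrices k n) ⟩
  count (spanSum f) (matrices k n) ∎
  where
  selected : List (F2^ n) → Bool
  selected U = isSubspaceOfDim k U ∧ sumOver f U
  count-bases : ∀ {U} → Nodup U → 𝟙 (selected U) * G k ≡ 𝟙 (selected U) * count (independentIn U) (matrices k n)
  count-bases {U} nodup with isSubspaceOfDim k U in isSub
  ... | false = refl
  ... | true  = cong (𝟙 (sumOver f U) *_) (sym (count-independentIn (isSubspaceOfDim-sound nodup isSub) k))

-- A single monomial

allTrue : F2^ n → Bool
allTrue = Vec.foldr _ _∧_ true

count-allTrue : ∀ n → count allTrue (allVecs n) ≡ 1
count-allTrue zero    = refl
count-allTrue (suc n) = begin
  count allTrue (allVecs (suc n))                                              ≡⟨ ∑-allVecs-suc n (𝟙 ∘ allTrue) ⟩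
  count (λ _ → false) (allVecs n) + count allTrue (allVecs n)                  ≡⟨ cong₂ _+_ (count-false (allVecs n)) (count-allTrue n) ⟩
  1                                                                            ∎

evalMono-⟦⟧ : (m : Monomial n) (R : Matrix j n) (c : F2^ j) → evalMono m (⟦ R ⟧ c) ≡ allTrue (⟦ select m R ⟧ c)
evalMono-⟦⟧ []          []      c = refl
evalMono-⟦⟧ (true ∷ m)  (ρ ∷ R) c = cong ((ρ ∙ c) ∧_) (evalMono-⟦⟧ m R c)
evalMono-⟦⟧ (false ∷ m) (ρ ∷ R) c = evalMono-⟦⟧ m R c

monomialSum : Monomial n → Matrix j n → Bool
monomialSum m R = ⨁ (span R) (evalMono m)

monomialSum≡ : (m : Monomial n) (R : Matrix j n) → monomialSum m R ≡ ⨁ (span (select m R)) allTrue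
monomialSum≡ {j = j} m R = begin
  ⨁ (map ⟦ R ⟧ (allVecs j)) (evalMono m)                ≡⟨ ⨁-map (evalMono m) ⟦ R ⟧ (allVecs j) ⟩
  ⨁[ c ∈ allVecs j ] evalMono m (⟦ R ⟧ c)                ≡⟨ ⨁-cong (evalMono-⟦⟧ m R) (allVecs j) ⟩
  ⨁[ c ∈ allVecs j ] allTrue (⟦ select m R ⟧ c)          ≡⟨ sym (⨁-map allTrue ⟦ select m R ⟧ (allVecs j)) ⟩
  ⨁ (span (select m R)) allTrue                          ∎

⨁-span-allTrue : (Q : Matrix k k) → ⨁ (span Q) allTrue ≡ isInjective Q
⨁-span-allTrue {k} Q with isInjective Q in inj
... | false = ⨁-span-nonInjective Q inj allTrue
... | true  = begin
  ⨁ (span Q) allTrue                                      ≡⟨ ⨁≡parity∘count allTrue (span Q) ⟩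
  parity (count allTrue (span Q))                         ≡⟨ cong parity (count-Nodup allTrue (span-Nodup Q inj)) ⟩
  parity (count (λ y → (y ∈ᵇ span Q) ∧ allTrue y) (allVecs k))
    ≡⟨ cong parity (count-cong (λ y → cong (_∧ allTrue y) (span-full y)) (allVecs k)) ⟩
  parity (count allTrue (allVecs k))                      ≡⟨ cong parity (count-allTrue k) ⟩
  true                                                    ∎
  where
  span-full : ∀ y → y ∈ᵇ span Q ≡ true
  span-full y = ⊆∧same-length⇒⊇ {L = span Q} {allVecs k} (span-Nodup Q inj) (allVecs-Nodup k) (λ v _ → ∈ᵇ-allVecs v)
                  (trans (length-allVecs k) (sym (length-span Q))) y (∈ᵇ-allVecs y)

count-isInjective-square : ∀ k → count isInjective (matrices k k) ≡ G k
count-isInjective-square k = begin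
  count isInjective (matrices k k)
    ≡⟨ count-cong (λ Q → sym (trans (cong (isInjective Q ∧_) (∈ᵇ⇒all (allVecs k) (λ c _ → ∈ᵇ-allVecs (⟦ Q ⟧ c))))
                                    (Bool.∧-identityʳ (isInjective Q)))) (matrices k k) ⟩
  count (independentIn (allVecs k)) (matrices k k)
    ≡⟨ count-independentIn (allVecs-IsSubspaceOfDim k) k ⟩
  G k ∎

count-monomialSum : ∀ (m : Monomial n) → ∣ m ∣ ≡ k →
  count (monomialSum m) (matrices k n) * 2 ^ (k * k) ≡ length (matrices k n) * G k
count-monomialSum {n} {k} m |m|≡k = begin
  count (monomialSum m) (matrices k n) * 2 ^ (k * k)
    ≡⟨ cong₂ _*_ (count-cong (monomialSum≡ m) (matrices k n)) 2^[k*k]≡K^∣m∣ ⟩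
  (∑[ R ∈ matrices k n ] F (select m R)) * length (allVecs k) ^ ∣ m ∣
    ≡⟨ ∑-select (allVecs k) m F ⟩
  length (allVecs k) ^ n * ∑ (matrices k ∣ m ∣) F
    ≡⟨ cong₂ _*_ (sym (length-vectorsOver (allVecs k) n)) (square |m|≡k) ⟩
  length (matrices k n) * G k ∎
  where
  F : ∀ {s} → Matrix k s → ℕ
  F Q = 𝟙 (⨁ (span Q) allTrue)
  2^[k*k]≡K^∣m∣ : 2 ^ (k * k) ≡ length (allVecs k) ^ ∣ m ∣
  2^[k*k]≡K^∣m∣ = begin
    2 ^ (k * k)               ≡⟨ sym (ℕ.^-*-assoc 2 k k) ⟩
    (2 ^ k) ^ k               ≡⟨ cong₂ _^_ (sym (length-allVecs k)) (sym |m|≡k) ⟩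
    length (allVecs k) ^ ∣ m ∣ ∎
  square : ∀ {s} → s ≡ k → ∑ (matrices k s) F ≡ G k
  square refl = trans (count-cong ⨁-span-allTrue (matrices k k)) (count-isInjective-square k)

-- Disjoint monomials

spanSum-∷ : ∀ (m : Monomial n) f (R : Matrix j n) → spanSum (m ∷ f) R ≡ monomialSum m R xor spanSum f R
spanSum-∷ m f R = ⨁-xor (evalMono m) (eval f) (span R)

select-agree : ∀ (S : Subset n) {u v : Vec A n} → AgreeOn S u v → select S u ≡ select S v
select-agree []          {[]}    {[]}    agree = refl
select-agree (true ∷ S)  {x ∷ u} {y ∷ v} agree = cong₂ _∷_ (agree zero refl) (select-agree S (agree ∘ suc))
select-agree (false ∷ S) {x ∷ u} {y ∷ v} agree = select-agree S (agree ∘ suc)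

monomialSum-dependsOnly : (m : Monomial n) → DependsOnlyOn m (monomialSum {j = j} m)
monomialSum-dependsOnly m R R' agree = begin
  monomialSum m R                   ≡⟨ monomialSum≡ m R ⟩
  ⨁ (span (select m R)) allTrue     ≡⟨ cong (λ Q → ⨁ (span Q) allTrue) (select-agree m agree) ⟩
  ⨁ (span (select m R')) allTrue    ≡⟨ sym (monomialSum≡ m R') ⟩
  monomialSum m R'                  ∎

disjoint⇒⊆∁ : ∀ {m m' : Monomial n} → Empty (m ∩ m') → ∀ i → lookup m' i ≡ true → lookup (∁ m) i ≡ true
disjoint⇒⊆∁ {m = m} {m'} m∩m'≡∅ i i∈m' with lookup m i in i∈m
... | false = trans (Vec.lookup-map i not m) (cong not i∈m)
... | true  = ⊥-elim (m∩m'≡∅ (i , Subset.x∈p∩q⁺ (Vec.lookup⇒[]= i m i∈m , Vec.lookup⇒[]= i m' i∈m')))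

spanSum-dependsOnly : (m : Monomial n) (f : ANF n) → All (λ m' → Empty (m ∩ m')) f → DependsOnlyOn (∁ m) (spanSum {j = j} f)
spanSum-dependsOnly m []       []               R R' agree = trans (⨁-false (span R)) (sym (⨁-false (span R')))
spanSum-dependsOnly m (m' ∷ f) (m∩m'≡∅ ∷ disj) R R' agree = begin
  spanSum (m' ∷ f) R                      ≡⟨ spanSum-∷ m' f R ⟩
  monomialSum m' R xor spanSum f R        ≡⟨ cong₂ _xor_ (monomialSum-dependsOnly m' R R' (λ i → agree i ∘ disjoint⇒⊆∁ m∩m'≡∅ i))
                                                         (spanSum-dependsOnly m f disj R R' agree) ⟩
  monomialSum m' R' xor spanSum f R'      ≡⟨ sym (spanSum-∷ m' f R') ⟩
  spanSum (m' ∷ f) R'                     ∎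

count-spanSum-∷ : ∀ (m : Monomial n) f → All (λ m' → Empty (m ∩ m')) f →
  length (matrices k n) * count (spanSum (m ∷ f)) (matrices k n)
    ≡ count (monomialSum m) (matrices k n) * count (not ∘ spanSum f) (matrices k n)
      + count (not ∘ monomialSum m) (matrices k n) * count (spanSum f) (matrices k n)
count-spanSum-∷ {n} {k} m f disj = begin
  length (matrices k n) * count (spanSum (m ∷ f)) (matrices k n)
    ≡⟨ cong (length (matrices k n) *_) (count-cong (spanSum-∷ m f) (matrices k n)) ⟩
  length (matrices k n) * count (λ R → monomialSum m R xor spanSum f R) (matrices k n)
    ≡⟨ count-xor (matrices k n) (monomialSum m) (spanSum f)
         (Independent-vectorsOver (allVecs k) m (monomialSum-dependsOnly m) (DependsOnlyOn-not {S = ∁ m} (spanSum-dependsOnly m f disj)))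
         (Independent-vectorsOver (allVecs k) m (DependsOnlyOn-not {S = m} (monomialSum-dependsOnly m)) (spanSum-dependsOnly m f disj)) ⟩
  count (monomialSum m) (matrices k n) * count (not ∘ spanSum f) (matrices k n)
    + count (not ∘ monomialSum m) (matrices k n) * count (spanSum f) (matrices k n) ∎

fromℕ : ℕ → ℚ
fromℕ n = ℤ.+ n / 1

fromℕ≡fromℤ : ∀ n → fromℕ n ≡ fromℤ (ℤ.+ n)
fromℕ≡fromℤ n = ℚ.↥p/↧p≡p (fromℤ (ℤ.+ n))

fromℕ-homo-+ : ∀ a b → fromℕ (a + b) ≡ fromℕ a +ℚ fromℕ b
fromℕ-homo-+ a b rewrite fromℕ≡fromℤ a | fromℕ≡fromℤ b =
  cong (_/ 1) (trans (ℤ.pos-+ a b) (sym (cong₂ ℤ._+_ (ℤ.*-identityʳ (ℤ.+ a)) (ℤ.*-identityʳ (ℤ.+ b)))))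

fromℕ-homo-* : ∀ a b → fromℕ (a * b) ≡ fromℕ a *ℚ fromℕ b
fromℕ-homo-* a b rewrite fromℕ≡fromℤ a | fromℕ≡fromℤ b = cong (_/ 1) (ℤ.pos-* a b)

/-*-cancel : ∀ a d .{{_ : NonZeroℕ d}} → (ℤ.+ a / d) *ℚ fromℕ d ≡ fromℕ a
/-*-cancel a (suc d) = ℚ.toℚᵘ-injective
  (ℚᵘ.≃-trans (ℚ.toℚᵘ-homo-* (ℤ.+ a / suc d) (fromℕ (suc d)))
  (ℚᵘ.≃-trans (ℚᵘ.*-cong (ℚ.toℚᵘ-fromℚᵘ (ℚᵘ.mkℚᵘ (ℤ.+ a) d)) (ℚ.toℚᵘ-fromℚᵘ (ℚᵘ.mkℚᵘ (ℤ.+ suc d) 0)))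
  (ℚᵘ.≃-trans (ℚᵘ.*≡* (trans (ℤ.*-identityʳ (ℤ.+ a ℤ.* ℤ.+ suc d))
                              (cong (λ m → ℤ.+ a ℤ.* ℤ.+ suc m) (sym (ℕ.*-identityʳ d)))))
  (ℚᵘ.≃-sym (ℚ.toℚᵘ-fromℚᵘ (ℚᵘ.mkℚᵘ (ℤ.+ a) 0))))))

*-cancelˡ : ∀ {p q} r .{{_ : NonZero r}} → r *ℚ p ≡ r *ℚ q → p ≡ q
*-cancelˡ {p} {q} r rp≡rq = begin
  p                  ≡⟨ sym (ℚ.*-identityˡ p) ⟩
  1ℚ *ℚ p            ≡⟨ cong (_*ℚ p) (sym (ℚ.*-inverseˡ r)) ⟩
  (1/ r *ℚ r) *ℚ p   ≡⟨ ℚ.*-assoc (1/ r) r p ⟩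
  1/ r *ℚ (r *ℚ p)   ≡⟨ cong (1/ r *ℚ_) rp≡rq ⟩
  1/ r *ℚ (r *ℚ q)   ≡⟨ sym (ℚ.*-assoc (1/ r) r q) ⟩
  (1/ r *ℚ r) *ℚ q   ≡⟨ cong (_*ℚ q) (ℚ.*-inverseˡ r) ⟩
  1ℚ *ℚ q            ≡⟨ ℚ.*-identityˡ q ⟩
  q                  ∎

*-cancelˡ-fromℕ : ∀ {p q} d .{{_ : NonZeroℕ d}} → fromℕ d *ℚ p ≡ fromℕ d *ℚ q → p ≡ q
*-cancelˡ-fromℕ {p} {q} (suc d) e =
  *-cancelˡ (fromℤ (ℤ.+ suc d)) (subst (λ r → r *ℚ p ≡ r *ℚ q) (fromℕ≡fromℤ (suc d)) e)

-- The bias M − 2a of an event met by a of M outcomes is multiplicative under xor of independent events.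
biases-multiply : ∀ {M γ γ' a b a' : ℕ} → M * a' ≡ γ * b + γ' * a → γ + γ' ≡ M → a + b ≡ M →
  fromℕ M *ℚ (fromℕ M -ℚ fromℕ 2 *ℚ fromℕ a')
    ≡ (fromℕ M -ℚ fromℕ 2 *ℚ fromℕ γ) *ℚ (fromℕ M -ℚ fromℕ 2 *ℚ fromℕ a)
biases-multiply {M} {γ} {γ'} {a} {b} {a'} rec γ+γ'≡M a+b≡M = begin
  m *ℚ (m -ℚ two *ℚ fromℕ a')
    ≡⟨ solve 2 (λ m a' → m :* (m :- con two :* a') := m :* m :- con two :* (m :* a')) refl m (fromℕ a') ⟩
  m *ℚ m -ℚ two *ℚ (m *ℚ fromℕ a')
    ≡⟨ cong (λ z → m *ℚ m -ℚ two *ℚ z) rec-ℚ ⟩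
  m *ℚ m -ℚ two *ℚ (fromℕ γ *ℚ fromℕ b +ℚ fromℕ γ' *ℚ fromℕ a)
    ≡⟨ cong₂ (λ u v → m *ℚ m -ℚ two *ℚ (fromℕ γ *ℚ u +ℚ v *ℚ fromℕ a))
             (complement {a} {b} a+b≡M) (complement {γ} {γ'} γ+γ'≡M) ⟩
  m *ℚ m -ℚ two *ℚ (fromℕ γ *ℚ (m -ℚ fromℕ a) +ℚ (m -ℚ fromℕ γ) *ℚ fromℕ a)
    ≡⟨ solve 3 (λ m g a → m :* m :- con two :* (g :* (m :- a) :+ (m :- g) :* a) := (m :- con two :* g) :* (m :- con two :* a))
             refl m (fromℕ γ) (fromℕ a) ⟩
  (m -ℚ two *ℚ fromℕ γ) *ℚ (m -ℚ two *ℚ fromℕ a) ∎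
  where
  open +-*-Solver
  m two : ℚ
  m = fromℕ M
  two = fromℕ 2
  rec-ℚ : fromℕ M *ℚ fromℕ a' ≡ fromℕ γ *ℚ fromℕ b +ℚ fromℕ γ' *ℚ fromℕ a
  rec-ℚ = begin
    fromℕ M *ℚ fromℕ a'                          ≡⟨ sym (fromℕ-homo-* M a') ⟩
    fromℕ (M * a')                               ≡⟨ cong fromℕ rec ⟩
    fromℕ (γ * b + γ' * a)                       ≡⟨ fromℕ-homo-+ (γ * b) (γ' * a) ⟩
    fromℕ (γ * b) +ℚ fromℕ (γ' * a)              ≡⟨ cong₂ _+ℚ_ (fromℕ-homo-* γ b) (fromℕ-homo-* γ' a) ⟩
    fromℕ γ *ℚ fromℕ b +ℚ fromℕ γ' *ℚ fromℕ a    ∎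
  complement : ∀ {c d} → c + d ≡ M → fromℕ d ≡ m -ℚ fromℕ c
  complement {c} {d} c+d≡M = begin
    fromℕ d                          ≡⟨ solve 2 (λ c d → d := (c :+ d) :- c) refl (fromℕ c) (fromℕ d) ⟩
    (fromℕ c +ℚ fromℕ d) -ℚ fromℕ c  ≡⟨ cong (_-ℚ fromℕ c) (trans (sym (fromℕ-homo-+ c d)) (cong fromℕ c+d≡M)) ⟩
    m -ℚ fromℕ c                     ∎

-- A uniformly random k×k matrix over F₂ is invertible with probability G k / 2^{k²}.
monomialBias : ℕ → ℚ
monomialBias k = 1ℚ -ℚ _/_ (ℤ.+ (2 * G k)) (2 ^ (k * k)) {{ℕ.m^n≢0 2 (k * k)}}

module _ (n k : ℕ) where

  private
    M : ℕ
    M = length (matrices k n)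

  instance
    matrices-nonEmpty : NonZeroℕ M
    matrices-nonEmpty = subst NonZeroℕ (sym (length-matrices k n)) (ℕ.m^n≢0 2 (k * n))

  bias-monomialSum : (m : Monomial n) → ∣ m ∣ ≡ k →
    fromℕ M -ℚ fromℕ 2 *ℚ fromℕ (count (monomialSum m) (matrices k n)) ≡ fromℕ M *ℚ monomialBias k
  bias-monomialSum m |m|≡k = begin
    fromℕ M -ℚ fromℕ 2 *ℚ fromℕ γ   ≡⟨ cong (fromℕ M -ℚ_) 2γ≡My ⟩
    fromℕ M -ℚ fromℕ M *ℚ y         ≡⟨ solve 2 (λ m y → m :- m :* y := m :* (con 1ℚ :- y)) refl (fromℕ M) y ⟩
    fromℕ M *ℚ (1ℚ -ℚ y)            ∎
    where
    open +-*-Solver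
    γ Q : ℕ
    γ = count (monomialSum m) (matrices k n)
    Q = 2 ^ (k * k)
    y : ℚ
    y = _/_ (ℤ.+ (2 * G k)) Q {{ℕ.m^n≢0 2 (k * k)}}
    2γ≡My : fromℕ 2 *ℚ fromℕ γ ≡ fromℕ M *ℚ y
    2γ≡My = *-cancelˡ-fromℕ Q {{ℕ.m^n≢0 2 (k * k)}} (begin
      fromℕ Q *ℚ (fromℕ 2 *ℚ fromℕ γ)   ≡⟨ cong (fromℕ Q *ℚ_) (sym (fromℕ-homo-* 2 γ)) ⟩
      fromℕ Q *ℚ fromℕ (2 * γ)          ≡⟨ sym (fromℕ-homo-* Q (2 * γ)) ⟩
      fromℕ (Q * (2 * γ))               ≡⟨ cong fromℕ (ℕ*.x∙yz≈y∙zx Q 2 γ) ⟩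
      fromℕ (2 * (γ * Q))               ≡⟨ cong (λ z → fromℕ (2 * z)) (count-monomialSum m |m|≡k) ⟩
      fromℕ (2 * (M * G k))             ≡⟨ cong fromℕ (ℕ*.x∙yz≈y∙xz 2 M (G k)) ⟩
      fromℕ (M * (2 * G k))             ≡⟨ fromℕ-homo-* M (2 * G k) ⟩
      fromℕ M *ℚ fromℕ (2 * G k)        ≡⟨ cong (fromℕ M *ℚ_) (sym (/-*-cancel (2 * G k) Q {{ℕ.m^n≢0 2 (k * k)}})) ⟩
      fromℕ M *ℚ (y *ℚ fromℕ Q)         ≡⟨ solve 3 (λ m y q → m :* (y :* q) := q :* (m :* y)) refl (fromℕ M) y (fromℕ Q) ⟩
      fromℕ Q *ℚ (fromℕ M *ℚ y)         ∎)

  bias-spanSum : (f : ANF n) → Homogeneous k f → ZeroIntersecting f →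
    fromℕ M -ℚ fromℕ 2 *ℚ fromℕ (count (spanSum f) (matrices k n)) ≡ fromℕ M *ℚ monomialBias k ^ℚ length f
  bias-spanSum [] [] [] = begin
    fromℕ M -ℚ fromℕ 2 *ℚ fromℕ (count (spanSum []) (matrices k n))
      ≡⟨ cong (λ c → fromℕ M -ℚ fromℕ 2 *ℚ fromℕ c)
              (trans (count-cong (λ R → ⨁-false (span R)) (matrices k n)) (count-false (matrices k n))) ⟩
    fromℕ M -ℚ fromℕ 2 *ℚ fromℕ 0
      ≡⟨ solve 1 (λ m → m :- con (fromℕ 2) :* con (fromℕ 0) := m :* con 1ℚ) refl (fromℕ M) ⟩
    fromℕ M *ℚ 1ℚ ∎
    where open +-*-Solver
  bias-spanSum (m ∷ f) (|m|≡k ∷ hom) (disj ∷ zi) = *-cancelˡ-fromℕ M (begin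
    fromℕ M *ℚ (fromℕ M -ℚ fromℕ 2 *ℚ fromℕ (count (spanSum (m ∷ f)) (matrices k n)))
      ≡⟨ biases-multiply {M} {count (monomialSum m) (matrices k n)} {count (not ∘ monomialSum m) (matrices k n)}
                         {count (spanSum f) (matrices k n)} {count (not ∘ spanSum f) (matrices k n)}
                         (count-spanSum-∷ m f disj) (count+count-not (monomialSum m) (matrices k n))
                                                     (count+count-not (spanSum f) (matrices k n)) ⟩
    (fromℕ M -ℚ fromℕ 2 *ℚ fromℕ (count (monomialSum m) (matrices k n)))
      *ℚ (fromℕ M -ℚ fromℕ 2 *ℚ fromℕ (count (spanSum f) (matrices k n)))
      ≡⟨ cong₂ _*ℚ_ (bias-monomialSum m |m|≡k) (bias-spanSum f hom zi) ⟩
    (fromℕ M *ℚ x) *ℚ (fromℕ M *ℚ x ^ℚ length f)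
      ≡⟨ solve 3 (λ m x X → (m :* x) :* (m :* X) := m :* (m :* (x :* X))) refl (fromℕ M) x (x ^ℚ length f) ⟩
    fromℕ M *ℚ (fromℕ M *ℚ x ^ℚ suc (length f)) ∎)
    where
    open +-*-Solver
    x : ℚ
    x = monomialBias k

  2G*|N|≡closed-form : (f : ANF n) → Homogeneous k f → ZeroIntersecting f →
    fromℕ (2 * G k) *ℚ fromℕ (length (N k f)) ≡ fromℕ (2 ^ (k * n)) *ℚ (1ℚ -ℚ monomialBias k ^ℚ length f)
  2G*|N|≡closed-form f hom zi = begin
    fromℕ (2 * G k) *ℚ fromℕ |N|      ≡⟨ sym (fromℕ-homo-* (2 * G k) |N|) ⟩
    fromℕ (2 * G k * |N|)             ≡⟨ cong fromℕ (trans (ℕ.*-assoc 2 (G k) |N|) (cong (2 *_) (ℕ.*-comm (G k) |N|))) ⟩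
    fromℕ (2 * (|N| * G k))           ≡⟨ cong (λ c → fromℕ (2 * c)) (length-N*G≡count-spanSum k f) ⟩
    fromℕ (2 * a)                     ≡⟨ fromℕ-homo-* 2 a ⟩
    two *ℚ fromℕ a                    ≡⟨ solve 3 (λ t a m → t :* a := m :- (m :- t :* a)) refl two (fromℕ a) (fromℕ M) ⟩
    fromℕ M -ℚ (fromℕ M -ℚ two *ℚ fromℕ a) ≡⟨ cong (fromℕ M -ℚ_) (bias-spanSum f hom zi) ⟩
    fromℕ M -ℚ fromℕ M *ℚ X           ≡⟨ solve 2 (λ m X → m :- m :* X := m :* (con 1ℚ :- X)) refl (fromℕ M) X ⟩
    fromℕ M *ℚ (1ℚ -ℚ X)              ≡⟨ cong (λ L → fromℕ L *ℚ (1ℚ -ℚ X)) (length-matrices k n) ⟩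
    fromℕ (2 ^ (k * n)) *ℚ (1ℚ -ℚ X)  ∎
    where
    open +-*-Solver
    |N| a : ℕ
    |N| = length (N k f)
    a = count (spanSum f) (matrices k n)
    two X : ℚ
    two = fromℕ 2
    X = monomialBias k ^ℚ length f

open import Data.Integer using (+_)

proposition5p6 : (n k : ℕ) (f : ANF n) →
    DistinctMonomials f → Homogeneous k f → ZeroIntersecting f →
    (+ length (N k f)) / 1 ≡ formula n k (length f)
proposition5p6 n k f _ hom zi = *-cancelˡ-fromℕ (2 * G k) {{2G-nonZero k}} (begin
  fromℕ (2 * G k) *ℚ fromℕ (length (N k f))  ≡⟨ 2G*|N|≡closed-form n k f hom zi ⟩
  fromℕ (2 ^ (k * n)) *ℚ (1ℚ -ℚ X)
    ≡⟨ cong (_*ℚ (1ℚ -ℚ X)) (sym (/-*-cancel (2 ^ (k * n)) (2 * G k) {{2G-nonZero k}})) ⟩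
  (D *ℚ fromℕ (2 * G k)) *ℚ (1ℚ -ℚ X)
    ≡⟨ solve 3 (λ d g x → (d :* g) :* x := g :* (d :* x)) refl D (fromℕ (2 * G k)) (1ℚ -ℚ X) ⟩
  fromℕ (2 * G k) *ℚ formula n k (length f)  ∎)
  where
  open +-*-Solver
  D X : ℚ
  D = _/_ (+ (2 ^ (k * n))) (2 * G k) {{2G-nonZero k}}
  X = monomialBias k ^ℚ length f
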